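{- Let $H$ be a Kekul\'ean hexagonal system. Let $\mathbb{Q}$ be the set of all induced subgraphs of $R(H)$ isomorphic to some hypercube $Q_n$ ($n\ge0$), ordered by $Q\le Q'$ iff $Q$ is a subgraph of $Q'$. Let $\mathbb{C}$ be the set of all Clar covers of $H$, ordered by $C\le C'$ iff $f(C)$ is a subgraph of $f(C')$. Then $(\mathbb{C},\le)$ is a poset and the posets $(\mathbb{C},\le)$ and $(\mathbb{Q},\le)$ are isomorphic.
   Context: A hexagonal system is a 2-connected finite plane graph in which every interior face is a regular hexagon of side length one; its hexagons are the boundaries of its interior faces. $H$ is Kekul\'ean if it has a perfect matching. A Clar cover of $H$ is a spanning subgraph of $H$ each of whose connected components is either a hexagon of $H$ or a single edge. The resonance graph $R(H)$ has the perfect matchings of $H$ as vertices, two perfect matchings $M,M'$ being adjacent iff $M\oplus M'$ is the edge set of a hexagon of $H$. A cycle is $M$-alternating if its edges alternately belong and do not belong to $M$. For a Clar cover $C$, $f(C)$ is the subgraph of $R(H)$ induced by all perfect matchings $M$ of $H$ such that every hexagon of $C$ is $M$-alternating and every single-edge component of $C$ belongs to $M$. -}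

module Defs where

open import Data.Bool using (Bool; true; false; _xor_)
open import Data.Integer using (ℤ; _+_; _*_; _<_; +_; -_; _-_)
open import Data.List using (List; _∷_; [])
open import Data.List.Membership.Propositional using (_∈_; _∉_)
open import Data.Nat using (ℕ; zero; suc)
open import Data.Vec using (Vec; []; _∷_)
open import Data.Product using (Σ; ∃; ∃-syntax; _×_; _,_; proj₁; proj₂)
open import Data.Sum using (_⊎_)
open import Function.Bundles using (_⇔_)
open import Level using (Level) renaming (suc to lsuc; zero to lzero)
open import Relation.Binary.PropositionalEquality using (_≡_; _≢_)
open import Relation.Nullary using (¬_)

-- The hexagonal (honeycomb) lattice, drawn as a "brick wall".  Lattice edges are
--   hor (x , y) : (x , y) — (x + 1 , y)
--   ver (x , y) : (x , y) — (x , y + 1)      (used only when x + y is even)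
-- Lattice hexagons (cells) are indexed by (a , b) ∈ ℤ²; the cell (a , b) is
-- the brick with lower-left corner (2a + b , b).  This is combinatorially
-- the honeycomb lattice (cell (a,b) has the six neighbours
-- (a±1,b), (a,b+1), (a-1,b+1), (a,b-1), (a+1,b-1)).

Vertex : Set
Vertex = ℤ × ℤ

data Dir : Set where
  hor ver : Dir

LEdge : Set
LEdge = Dir × Vertex

ends : LEdge → Vertex × Vertex
ends (hor , x , y) = (x , y) , (x + + 1 , y)
ends (ver , x , y) = (x , y) , (x , y + + 1)

Incident : LEdge → Vertex → Set
Incident e v = v ≡ proj₁ (ends e) ⊎ v ≡ proj₂ (ends e)

Joins : LEdge → Vertex → Vertex → Set
Joins e u v = ends e ≡ (u , v) ⊎ ends e ≡ (v , u)

Cell : Set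
Cell = ℤ × ℤ

corner : Cell → Vertex
corner (a , b) = (+ 2 * a + b , b)

-- the six edges of a cell, in cyclic order around the hexagon
hexEdgeVec : Cell → Vec LEdge 6
hexEdgeVec c with corner c
... | x , y =
  (hor , x , y) ∷ (hor , x + + 1 , y) ∷ (ver , x + + 2 , y) ∷
  (hor , x + + 1 , y + + 1) ∷ (hor , x , y + + 1) ∷ (ver , x , y) ∷ []

hexEdges : Cell → List LEdge
hexEdges c with hexEdgeVec c
... | e₀ ∷ e₁ ∷ e₂ ∷ e₃ ∷ e₄ ∷ e₅ ∷ [] = e₀ ∷ e₁ ∷ e₂ ∷ e₃ ∷ e₄ ∷ e₅ ∷ []

hexVerts : Cell → List Vertex
hexVerts c with corner c
... | x , y =
  (x , y) ∷ (x + + 1 , y) ∷ (x + + 2 , y) ∷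
  (x + + 2 , y + + 1) ∷ (x + + 1 , y + + 1) ∷ (x , y + + 1) ∷ []

neighbours : Cell → List Cell
neighbours (a , b) =
  (a + + 1 , b) ∷ (a - + 1 , b) ∷ (a , b + + 1) ∷ (a - + 1 , b + + 1) ∷
  (a , b - + 1) ∷ (a + + 1 , b - + 1) ∷ []

-- The plane graph G(S) determined by a finite list S of lattice cells:
-- the union of the boundaries of the cells in S.

_∈V_ : Vertex → List Cell → Set
v ∈V S = ∃[ c ] (c ∈ S × v ∈ hexVerts c)

_∈E_ : LEdge → List Cell → Set
e ∈E S = ∃[ c ] (c ∈ S × e ∈ hexEdges c)

data Path (E : LEdge → Set) : Vertex → Vertex → Set where
  here : ∀ {v} → Path E v v
  step : ∀ {u v w} (e : LEdge) → E e → Joins e u v → Path E v w → Path E u w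

Connected : List Cell → Set
Connected S = ∀ u w → u ∈V S → w ∈V S → Path (λ e → e ∈E S) u w

ConnectedWithout : List Cell → Vertex → Set
ConnectedWithout S v =
  ∀ u w → u ∈V S → w ∈V S → u ≢ v → w ≢ v →
  Path (λ e → e ∈E S × ¬ Incident e v) u w

TwoConnected : List Cell → Set
TwoConnected S =
  (∃[ u ] ∃[ v ] ∃[ w ] (u ∈V S × v ∈V S × w ∈V S × u ≢ v × v ≢ w × u ≢ w))
  × Connected S
  × (∀ v → v ∈V S → ConnectedWithout S v)

-- The faces of G(S) other than the cells of S are the edge-connected
-- components of the complement of S (in the cell lattice).  "Every interior
-- face is a hexagon of S" means every cell outside S lies in the unbounded
-- face, i.e. can be joined, through cells outside S, to a cell lying strictly
-- above every cell of S.
data CellPath (S : List Cell) : Cell → Cell → Set where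
  here : ∀ {c} → CellPath S c c
  step : ∀ {c c' d} → c' ∈ neighbours c → c' ∉ S → CellPath S c' d → CellPath S c d

NoHoles : List Cell → Set
NoHoles S =
  ∀ c → c ∉ S → ∃[ d ] (CellPath S c d × (∀ c' → c' ∈ S → proj₂ c' < proj₂ d))

record HexSystem : Set where
  field
    cells        : List Cell
    twoConnected : TwoConnected cells
    noHoles      : NoHoles cells
open HexSystem public

EdgeSet : Set
EdgeSet = LEdge → Bool

_∈ₑ_ : LEdge → EdgeSet → Set
e ∈ₑ M = M e ≡ true

IsPerfectMatching : HexSystem → EdgeSet → Set
IsPerfectMatching H M =
  (∀ e → e ∈ₑ M → e ∈E cells H) ×
  (∀ v → v ∈V cells H →
     (∃[ e ] (e ∈ₑ M × Incident e v)) ×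
     (∀ e e' → e ∈ₑ M → e' ∈ₑ M → Incident e v → Incident e' v → e ≡ e'))

Kekulean : HexSystem → Set
Kekulean H = ∃[ M ] IsPerfectMatching H M

PM : HexSystem → Set
PM H = Σ EdgeSet (IsPerfectMatching H)

_≈M_ : ∀ {H} → PM H → PM H → Set
M ≈M M' = ∀ e → proj₁ M e ≡ proj₁ M' e

Alternating : EdgeSet → Cell → Set
Alternating M c with hexEdgeVec c
... | e₀ ∷ e₁ ∷ e₂ ∷ e₃ ∷ e₄ ∷ e₅ ∷ [] =
  M e₀ ≢ M e₁ × M e₁ ≢ M e₂ × M e₂ ≢ M e₃ ×
  M e₃ ≢ M e₄ × M e₄ ≢ M e₅ × M e₅ ≢ M e₀

-- adjacency in the resonance graph R(H): M ⊕ M' is the edge set of a hexagon of H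
ResAdj : ∀ {H} → PM H → PM H → Set
ResAdj {H} M M' =
  ∃[ c ] (c ∈ cells H ×
    (∀ e → ((proj₁ M e xor proj₁ M' e) ≡ true) ⇔ e ∈ hexEdges c))

-- the hexagon c (all its vertices and edges) is a connected component of C
HexComp : EdgeSet → Cell → Set
HexComp C c =
  (∀ e → e ∈ hexEdges c → e ∈ₑ C) ×
  (∀ e v → e ∈ₑ C → v ∈ hexVerts c → Incident e v → e ∈ hexEdges c)

-- the single edge e (with its two end vertices) is a connected component of C
EdgeComp : EdgeSet → LEdge → Set
EdgeComp C e =
  e ∈ₑ C ×
  (∀ e' v → e' ∈ₑ C → Incident e v → Incident e' v → e' ≡ e)

IsClarCover : HexSystem → EdgeSet → Set
IsClarCover H C =
  (∀ e → e ∈ₑ C → e ∈E cells H) ×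
  (∀ v → v ∈V cells H →
     (∃[ c ] (c ∈ cells H × HexComp C c × v ∈ hexVerts c)) ⊎
     (∃[ e ] (EdgeComp C e × Incident e v)))

ClarCover : HexSystem → Set
ClarCover H = Σ EdgeSet (IsClarCover H)

_≈C_ : ∀ {H} → ClarCover H → ClarCover H → Set
C ≈C C' = ∀ e → proj₁ C e ≡ proj₁ C' e

-- M is a vertex of f(C)
InF : ∀ {H} → ClarCover H → PM H → Set
InF {H} C M =
  (∀ c → c ∈ cells H → HexComp (proj₁ C) c → Alternating (proj₁ M) c) ×
  (∀ e → EdgeComp (proj₁ C) e → e ∈ₑ proj₁ M)

-- C ≤ C' iff the induced subgraph f(C) of R(H) is a subgraph of f(C')
-- (for induced subgraphs of one graph: inclusion of vertex sets)
_≤C_ : ∀ {H} → ClarCover H → ClarCover H → Set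
_≤C_ {H} C C' = ∀ M → InF {H} C M → InF {H} C' M

-- Hamming distance; Q_n has vertex set Vec Bool n, adjacency = distance 1
hamming : ∀ {n} → Vec Bool n → Vec Bool n → ℕ
hamming [] [] = zero
hamming (true ∷ xs) (true ∷ ys) = hamming xs ys
hamming (false ∷ xs) (false ∷ ys) = hamming xs ys
hamming (true ∷ xs) (false ∷ ys) = suc (hamming xs ys)
hamming (false ∷ xs) (true ∷ ys) = suc (hamming xs ys)

CubeAdj : ∀ {n} → Vec Bool n → Vec Bool n → Set
CubeAdj x y = hamming x y ≡ suc zero

InducesCube : ∀ {H} → (PM H → Set) → ℕ → Set
InducesCube {H} P n =
  Σ (Vec Bool n → PM H) λ g → (
    (∀ M → P M ⇔ (∃[ x ] (_≈M_ {H} (g x) M))) ×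
    (∀ x y → _≈M_ {H} (g x) (g y) → x ≡ y) ×
    (∀ x y → CubeAdj x y ⇔ ResAdj {H} (g x) (g y)))

-- induced subgraphs of R(H) (identified with their vertex sets) isomorphic to some Q_n
InducedCube : HexSystem → Set₁
InducedCube H = Σ (PM H → Set) (λ P → ∃[ n ] InducesCube {H} P n)

_≈Q_ : ∀ {H} → InducedCube H → InducedCube H → Set
_≈Q_ {H} Q Q' = ∀ (M : PM H) → proj₁ Q M ⇔ proj₁ Q' M

_≤Q_ : ∀ {H} → InducedCube H → InducedCube H → Set
_≤Q_ {H} Q Q' = ∀ (M : PM H) → proj₁ Q M → proj₁ Q' M

module Submission where

open import Defs
open import Data.Product using (∃; _×_)
open import Relation.Binary.Structures using (IsPartialOrder)
open import Relation.Binary.Morphism.Structures using (IsOrderIsomorphism)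

import Algebra.Properties.AbelianGroup
open import Data.Bool using (Bool; true; false; not; _xor_; _∧_; _∨_)
open import Data.Bool.Properties
  using ( ¬-not; not-¬; not-involutive; not-injective; not-distribˡ-xor; not-distribʳ-xor
        ; xor-same; xor-identityʳ; xor-assoc; xor-comm; xor-inverseʳ; xor-annihilates-not
        ; ∧-zeroʳ; ∧-identityʳ; ∨-zeroʳ; ∨-identityʳ; ⇔→≡ )
  renaming (_≟_ to _≟ᵇ_)
open import Data.Empty using (⊥; ⊥-elim)
open import Data.Fin as Fin using (Fin; zero; suc)
open import Data.Fin.Properties as Fin using (all?; any?)
open import Data.Integer as ℤ using (ℤ; +_; -[1+_]; _+_; _*_; -_)
import Data.Integer.Properties as ℤ
open import Data.Integer.Tactic.RingSolver using (solve-∀)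
open import Data.List as List using (List; filter; deduplicate; length)
open import Data.List.Membership.Propositional using (_∈_; _∉_)
import Data.List.Membership.DecPropositional as DecMembership
open import Data.List.Membership.Propositional.Properties
  using (∈-tabulate⁺; ∈-tabulate⁻; ∈-filter⁺; ∈-filter⁻; ∈-deduplicate⁺; ∈-deduplicate⁻)
open import Data.List.Relation.Unary.All as All using (All)
open import Data.List.Relation.Unary.Any using (here; there)
open import Data.List.Relation.Unary.Unique.Propositional using (Unique; _∷_)
open import Data.List.Relation.Unary.Unique.DecPropositional.Properties using (deduplicate-!)
open import Data.Nat as ℕ using (ℕ; zero; suc)
import Data.Nat.Properties as ℕ
open import Data.Product using (∃-syntax; _,_; proj₁; proj₂; curry)
import Data.Product.Properties as Product
open import Data.Sum using (_⊎_; inj₁; inj₂)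
open import Data.Vec using (Vec; []; _∷_; lookup; replicate; tabulate; fromList; _[_]≔_)
open import Data.Vec.Properties
  using ( lookup∘tabulate; tabulate∘lookup; tabulate-cong; lookup-replicate
        ; lookup∘update; lookup∘update′; []≔-idempotent; []≔-lookup; []≔-commutes )
open import Function using (_∘_; _∘₂_; case_of_)
open import Function.Bundles using (_⇔_; mk⇔; Equivalence)
open import Relation.Binary.Definitions using (DecidableEquality)
open import Relation.Binary.PropositionalEquality
open import Relation.Nullary using (¬_; Dec; yes; no; does; contradiction)
open import Relation.Nullary.Decidable
  using (from-yes; dec-true; dec-false; decidable-stable; ¬?; _×-dec_; _⊎-dec_; _→-dec_)

module ℤ+ = Algebra.Properties.AbelianGroup ℤ.+-0-abelianGroup

-- A Clar cover C consists of pairwise vertex-disjoint hexagons h₁, …, hₙ and single edges.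
-- Keeping every other edge of each hᵢ turns C into a perfect matching M₀ on which every hᵢ
-- alternates, and x ↦ M₀ ⊕ ⨁ {hᵢ ∣ xᵢ = 1} maps Qₙ onto f(C). Since two distinct cells share
-- at most one edge, two such matchings differ by a single hexagon exactly when x and y differ
-- in one coordinate, so this map is an isomorphism onto an induced subgraph.
-- Conversely, let g be an isomorphism from Qₙ onto an induced subgraph of R(H), and let cᵢ be
-- the hexagon between g(0) and g(eᵢ). In a 4-cycle of R(H) opposite edges carry the same
-- hexagon: the hexagons of the two sides next to a side each share at most one edge with it,
-- so four of its edges lie on the opposite side. Hence g(x) = g(0) ⊕ ⨁ {cᵢ ∣ xᵢ = 1},
-- the cᵢ are disjoint, and g(0) ∪ ⋃ cᵢ is a Clar cover whose f is the image of g.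
-- Finally C is the union of the perfect matchings in f(C), which makes C ↦ f(C) injective
-- and the order on Clar covers antisymmetric.

xor-trueʳ : ∀ a → a xor true ≡ not a
xor-trueʳ false = refl
xor-trueʳ true  = refl

xor-solveˡ : ∀ a {b c} → a xor b ≡ c → b ≡ a xor c
xor-solveˡ false refl = refl
xor-solveˡ true  refl = sym (not-involutive _)

xor-solveʳ : ∀ {a b} c → a ≡ b xor c → b ≡ a xor c
xor-solveʳ {b = false} false refl = refl
xor-solveʳ {b = false} true  refl = refl
xor-solveʳ {b = true}  false refl = refl
xor-solveʳ {b = true}  true  refl = refl

xor-cancelˡ : ∀ a {b c} → a xor b ≡ a xor c → b ≡ c
xor-cancelˡ false eq = eq
xor-cancelˡ true  eq = not-injective eq

xor-cancel-common : ∀ u v w → (u xor v) xor (u xor w) ≡ v xor w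
xor-cancel-common false v w = refl
xor-cancel-common true  v w = xor-annihilates-not v w

xor-chain : ∀ a b c → (a xor b) xor (b xor c) ≡ a xor c
xor-chain a b c = begin
  (a xor b) xor (b xor c) ≡⟨ xor-assoc a b (b xor c) ⟩
  a xor (b xor (b xor c)) ≡⟨ cong (a xor_) (xor-assoc b b c) ⟨
  a xor ((b xor b) xor c) ≡⟨ cong (λ z → a xor (z xor c)) (xor-same b) ⟩
  a xor c                 ∎
  where open ≡-Reasoning

xor-≢ : ∀ {a b} → a ≢ b → a xor b ≡ true
xor-≢ {false} {false} a≢b = contradiction refl a≢b
xor-≢ {false} {true}  a≢b = refl
xor-≢ {true}  {false} a≢b = refl
xor-≢ {true}  {true}  a≢b = contradiction refl a≢b

xor-≡ : ∀ {a b} → a ≡ b → a xor b ≡ false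
xor-≡ {a} refl = xor-same a

xor-false⁻ : ∀ {a b} → a xor b ≡ false → a ≡ b
xor-false⁻ {false} {false} _ = refl
xor-false⁻ {true}  {true}  _ = refl

-- Lattice cells

-- Equal to x + + n, but reduces to x for n = 0, as the coordinates in hexEdgeVec and hexVerts do.
shift : ℤ → ℕ → ℤ
shift x zero    = x
shift x (suc n) = x + + suc n

shift≡+ : ∀ x n → shift x n ≡ x + + n
shift≡+ x zero    = sym (ℤ.+-identityʳ x)
shift≡+ x (suc n) = refl

shift-≡⇒+-≡ : ∀ x x' i j → shift x i ≡ shift x' j → x + + i ≡ x' + + j
shift-≡⇒+-≡ x x' i j eq = trans (sym (shift≡+ x i)) (trans eq (shift≡+ x' j))

shift-injectiveʳ : ∀ x {i j} → shift x i ≡ shift x j → i ≡ j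
shift-injectiveʳ x {i} {j} eq = ℤ.+-injective (ℤ+.∙-cancelˡ x _ _ (shift-≡⇒+-≡ x x i j eq))

shift-injectiveˡ : ∀ {x x'} i → shift x i ≡ shift x' i → x ≡ x'
shift-injectiveˡ {x} {x'} i eq = ℤ+.∙-cancelʳ (+ i) _ _ (shift-≡⇒+-≡ x x' i i eq)

shift-suc : ∀ x i → shift x i + + 1 ≡ shift x (suc i)
shift-suc x zero    = refl
shift-suc x (suc i) = trans (ℤ.+-assoc x (+ suc i) (+ 1)) (cong (λ k → x + + suc k) (ℕ.+-comm i 1))

shift-difference : ∀ {x x'} i j i' j' → shift x i ≡ shift x' j → shift x i' ≡ shift x' j' →
                   i ℕ.+ j' ≡ j ℕ.+ i'
shift-difference {x} {x'} i j i' j' eq eq' = ℤ.+-injective (ℤ+.∙-cancelˡ x _ _ (begin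
    x + + (i ℕ.+ j')     ≡⟨ cong (λ z → x + z) (ℤ.pos-+ i j') ⟩
    x + (+ i + + j')     ≡⟨ ℤ.+-assoc x (+ i) (+ j') ⟨
    (x + + i) + + j'     ≡⟨ cong (_+ + j') (shift-≡⇒+-≡ x x' i j eq) ⟩
    (x' + + j) + + j'    ≡⟨ swap x' (+ j) (+ j') ⟩
    (x' + + j') + + j    ≡⟨ cong (_+ + j) (shift-≡⇒+-≡ x x' i' j' eq') ⟨
    (x + + i') + + j     ≡⟨ swap x (+ i') (+ j) ⟩
    (x + + j) + + i'     ≡⟨ ℤ.+-assoc x (+ j) (+ i') ⟩
    x + (+ j + + i')     ≡⟨ cong (λ z → x + z) (ℤ.pos-+ j i') ⟨
    x + + (j ℕ.+ i')     ∎))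
  where
  open ≡-Reasoning
  swap : ∀ a b c → (a + b) + c ≡ (a + c) + b
  swap = solve-∀

-- Positions 0, …, 5 number the vertices and edges of a cell as in hexVerts and hexEdgeVec:
-- edge p joins vertex p to vertex nxt p, and ends lists them as src p, tgt p.

pattern f0 = zero
pattern f1 = suc zero
pattern f2 = suc (suc zero)
pattern f3 = suc (suc (suc zero))
pattern f4 = suc (suc (suc (suc zero)))
pattern f5 = suc (suc (suc (suc (suc zero))))

nxt prev src tgt : Fin 6 → Fin 6
nxt f0 = f1
nxt f1 = f2
nxt f2 = f3
nxt f3 = f4
nxt f4 = f5
nxt f5 = f0
prev f0 = f5
prev f1 = f0
prev f2 = f1
prev f3 = f2
prev f4 = f3
prev f5 = f4
src f3 = f4
src f4 = f5
src f5 = f0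
src p  = p
tgt f0 = f1
tgt f1 = f2
tgt f2 = f3
tgt p  = p

edgeDir : Fin 6 → Dir
edgeDir f2 = ver
edgeDir f5 = ver
edgeDir _  = hor

edgeDx edgeDy vertexDx vertexDy : Fin 6 → ℕ
edgeDx f1 = 1
edgeDx f2 = 2
edgeDx f3 = 1
edgeDx _  = 0
edgeDy f3 = 1
edgeDy f4 = 1
edgeDy _  = 0
vertexDx f1 = 1
vertexDx f2 = 2
vertexDx f3 = 2
vertexDx f4 = 1
vertexDx _  = 0
vertexDy f3 = 1
vertexDy f4 = 1
vertexDy f5 = 1
vertexDy _  = 0

oddPosition : Fin 6 → Bool
oddPosition f1 = true
oddPosition f3 = true
oddPosition f5 = true
oddPosition _  = false

opaque
  cornerX : Cell → ℤ
  cornerX c = proj₁ (corner c)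

latticeVertex : Cell → ℕ → ℕ → Vertex
latticeVertex c i j = shift (cornerX c) i , shift (proj₂ c) j

hexEdge : Cell → Fin 6 → LEdge
hexEdge c p = edgeDir p , latticeVertex c (edgeDx p) (edgeDy p)

hexVertex : Cell → Fin 6 → Vertex
hexVertex c k = latticeVertex c (vertexDx k) (vertexDy k)

opaque
  unfolding cornerX

  cornerX-≡ : ∀ a b → cornerX (a , b) ≡ + 2 * a + b
  cornerX-≡ a b = refl

  hexEdges-≡ : ∀ c → hexEdges c ≡ List.tabulate (hexEdge c)
  hexEdges-≡ c = refl

  hexVerts-≡ : ∀ c → hexVerts c ≡ List.tabulate (hexVertex c)
  hexVerts-≡ c = refl

  Alternating-≡ : ∀ M c → Alternating M c ≡
    (M (hexEdge c f0) ≢ M (hexEdge c f1) × M (hexEdge c f1) ≢ M (hexEdge c f2) ×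
     M (hexEdge c f2) ≢ M (hexEdge c f3) × M (hexEdge c f3) ≢ M (hexEdge c f4) ×
     M (hexEdge c f4) ≢ M (hexEdge c f5) × M (hexEdge c f5) ≢ M (hexEdge c f0))
  Alternating-≡ M c = refl

_≟ᴰ_ : DecidableEquality Dir
hor ≟ᴰ hor = yes refl
hor ≟ᴰ ver = no λ ()
ver ≟ᴰ hor = no λ ()
ver ≟ᴰ ver = yes refl

nxt-prev : ∀ k → nxt (prev k) ≡ k
nxt-prev = from-yes (all? λ k → nxt (prev k) Fin.≟ k)

prev-nxt : ∀ k → prev (nxt k) ≡ k
prev-nxt = from-yes (all? λ k → prev (nxt k) Fin.≟ k)

prev-≢ : ∀ k → prev k ≢ k
prev-≢ = from-yes (all? λ k → ¬? (prev k Fin.≟ k))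

oddPosition-nxt : ∀ p → oddPosition (nxt p) ≡ not (oddPosition p)
oddPosition-nxt = from-yes (all? λ p → oddPosition (nxt p) ≟ᵇ not (oddPosition p))

vertexOffset-injective : ∀ k k' → vertexDx k ≡ vertexDx k' → vertexDy k ≡ vertexDy k' → k ≡ k'
vertexOffset-injective = from-yes (all? λ k → all? λ k' →
  vertexDx k ℕ.≟ vertexDx k' →-dec vertexDy k ℕ.≟ vertexDy k' →-dec k Fin.≟ k')

edgeOffset-injective : ∀ p p' → edgeDir p ≡ edgeDir p' → edgeDx p ≡ edgeDx p' → edgeDy p ≡ edgeDy p' →
                       p ≡ p'
edgeOffset-injective = from-yes (all? λ p → all? λ p' →
  edgeDir p ≟ᴰ edgeDir p' →-dec edgeDx p ℕ.≟ edgeDx p' →-dec edgeDy p ℕ.≟ edgeDy p' →-dec p Fin.≟ p')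

endpoint⇒position : ∀ p k → k ≡ src p ⊎ k ≡ tgt p → p ≡ k ⊎ p ≡ prev k
endpoint⇒position = from-yes (all? λ p → all? λ k →
  (k Fin.≟ src p ⊎-dec k Fin.≟ tgt p) →-dec (p Fin.≟ k ⊎-dec p Fin.≟ prev k))

position⇒endpoint : ∀ k → (k ≡ src k ⊎ k ≡ tgt k) × (k ≡ src (prev k) ⊎ k ≡ tgt (prev k))
position⇒endpoint = from-yes (all? λ k →
  (k Fin.≟ src k ⊎-dec k Fin.≟ tgt k) ×-dec (k Fin.≟ src (prev k) ⊎-dec k Fin.≟ tgt (prev k)))

ends-hexEdge : ∀ c p → ends (hexEdge c p) ≡ (hexVertex c (src p) , hexVertex c (tgt p))
ends-hexEdge c f0 = refl
ends-hexEdge c f1 = cong (λ x → latticeVertex c 1 0 , x , proj₂ c) (shift-suc (cornerX c) 1)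
ends-hexEdge c f2 = refl
ends-hexEdge c f3 = cong (λ x → latticeVertex c 1 1 , x , shift (proj₂ c) 1) (shift-suc (cornerX c) 1)
ends-hexEdge c f4 = refl
ends-hexEdge c f5 = refl

hexVertex-injective : ∀ c {k k'} → hexVertex c k ≡ hexVertex c k' → k ≡ k'
hexVertex-injective c {k} {k'} eq = vertexOffset-injective k k'
  (shift-injectiveʳ _ (cong proj₁ eq)) (shift-injectiveʳ _ (cong proj₂ eq))

hexEdge-injective : ∀ c {p p'} → hexEdge c p ≡ hexEdge c p' → p ≡ p'
hexEdge-injective c {p} {p'} eq = edgeOffset-injective p p' (cong proj₁ eq)
  (shift-injectiveʳ _ (cong (proj₁ ∘ proj₂) eq)) (shift-injectiveʳ _ (cong (proj₂ ∘ proj₂) eq))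

incident⇒endpoint : ∀ c p k → Incident (hexEdge c p) (hexVertex c k) → k ≡ src p ⊎ k ≡ tgt p
incident⇒endpoint c p k (inj₁ eq) = inj₁ (hexVertex-injective c (trans eq (cong proj₁ (ends-hexEdge c p))))
incident⇒endpoint c p k (inj₂ eq) = inj₂ (hexVertex-injective c (trans eq (cong proj₂ (ends-hexEdge c p))))

endpoint⇒incident : ∀ c p k → k ≡ src p ⊎ k ≡ tgt p → Incident (hexEdge c p) (hexVertex c k)
endpoint⇒incident c p k (inj₁ refl) = inj₁ (sym (cong proj₁ (ends-hexEdge c p)))
endpoint⇒incident c p k (inj₂ refl) = inj₂ (sym (cong proj₂ (ends-hexEdge c p)))

incident-position : ∀ c p k → Incident (hexEdge c p) (hexVertex c k) → p ≡ k ⊎ p ≡ prev k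
incident-position c p k inc = endpoint⇒position p k (incident⇒endpoint c p k inc)

incident-self : ∀ c k → Incident (hexEdge c k) (hexVertex c k)
incident-self c k = endpoint⇒incident c k k (proj₁ (position⇒endpoint k))

incident-prev : ∀ c k → Incident (hexEdge c (prev k)) (hexVertex c k)
incident-prev c k = endpoint⇒incident c (prev k) k (proj₂ (position⇒endpoint k))

hexEdge-∈ : ∀ c p → hexEdge c p ∈ hexEdges c
hexEdge-∈ c p = subst (hexEdge c p ∈_) (sym (hexEdges-≡ c)) (∈-tabulate⁺ {f = hexEdge c} p)

∈-hexEdges⁻ : ∀ c {e} → e ∈ hexEdges c → ∃[ p ] e ≡ hexEdge c p
∈-hexEdges⁻ c {e} e∈ = ∈-tabulate⁻ (subst (e ∈_) (hexEdges-≡ c) e∈)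

hexVertex-∈ : ∀ c k → hexVertex c k ∈ hexVerts c
hexVertex-∈ c k = subst (hexVertex c k ∈_) (sym (hexVerts-≡ c)) (∈-tabulate⁺ {f = hexVertex c} k)

∈-hexVerts⁻ : ∀ c {v} → v ∈ hexVerts c → ∃[ k ] v ≡ hexVertex c k
∈-hexVerts⁻ c {v} v∈ = ∈-tabulate⁻ (subst (v ∈_) (hexVerts-≡ c) v∈)

endpoint-∈-hexVerts : ∀ c {e v} → e ∈ hexEdges c → Incident e v → v ∈ hexVerts c
endpoint-∈-hexVerts c e∈ inc with ∈-hexEdges⁻ c e∈
... | p , refl with inc
... | inj₁ refl = subst (_∈ hexVerts c) (sym (cong proj₁ (ends-hexEdge c p))) (hexVertex-∈ c (src p))
... | inj₂ refl = subst (_∈ hexVerts c) (sym (cong proj₂ (ends-hexEdge c p))) (hexVertex-∈ c (tgt p))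

parityℕ : ℕ → Bool
parityℕ zero    = false
parityℕ (suc n) = not (parityℕ n)

parity : ℤ → Bool
parity (+ n)    = parityℕ n
parity -[1+ n ] = parityℕ (suc n)

parityℕ-+ : ∀ m n → parityℕ (m ℕ.+ n) ≡ parityℕ m xor parityℕ n
parityℕ-+ zero    n = refl
parityℕ-+ (suc m) n = trans (cong not (parityℕ-+ m n)) (not-distribˡ-xor (parityℕ m) (parityℕ n))

parity-+1 : ∀ x → parity (x + + 1) ≡ not (parity x)
parity-+1 (+ n)        = trans (parityℕ-+ n 1) (xor-trueʳ (parityℕ n))
parity-+1 -[1+ zero ]  = refl
parity-+1 -[1+ suc n ] = sym (not-involutive _)

parity-+ℕ : ∀ x n → parity (x + + n) ≡ parity x xor parityℕ n
parity-+ℕ x zero    = trans (cong parity (ℤ.+-identityʳ x)) (sym (xor-identityʳ (parity x)))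
parity-+ℕ x (suc n) = begin
  parity (x + + suc n)         ≡⟨ cong (λ k → parity (x + + k)) (ℕ.+-comm 1 n) ⟩
  parity (x + + (n ℕ.+ 1))     ≡⟨ cong parity (ℤ.+-assoc x (+ n) (+ 1)) ⟨
  parity ((x + + n) + + 1)     ≡⟨ parity-+1 (x + + n) ⟩
  not (parity (x + + n))       ≡⟨ cong not (parity-+ℕ x n) ⟩
  not (parity x xor parityℕ n) ≡⟨ not-distribʳ-xor (parity x) (parityℕ n) ⟩
  parity x xor not (parityℕ n) ∎
  where open ≡-Reasoning

parity-+ : ∀ x y → parity (x + y) ≡ parity x xor parity y
parity-+ x (+ n)    = parity-+ℕ x n
parity-+ x -[1+ n ] = xor-solveʳ (parityℕ (suc n))
  (trans (cong parity (x≡x+y-y x -[1+ n ])) (parity-+ℕ (x + -[1+ n ]) (suc n)))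
  where
  x≡x+y-y : ∀ x y → x ≡ (x + y) + (- y)
  x≡x+y-y = solve-∀

parity-2* : ∀ a → parity (+ 2 * a) ≡ false
parity-2* a = trans (cong parity (2*a≡a+a a)) (trans (parity-+ a a) (xor-same (parity a)))
  where
  2*a≡a+a : ∀ a → + 2 * a ≡ a + a
  2*a≡a+a = solve-∀

colour : Vertex → Bool
colour (x , y) = parity x xor parity y

colour-latticeVertex : ∀ c i j → colour (latticeVertex c i j) ≡ parityℕ i xor parityℕ j
colour-latticeVertex (a , b) i j = begin
  parity (shift (cornerX (a , b)) i) xor parity (shift b j)
    ≡⟨ cong₂ _xor_ (parity-shift (cornerX (a , b)) i) (parity-shift b j) ⟩
  (parity (cornerX (a , b)) xor parityℕ i) xor (parity b xor parityℕ j)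
    ≡⟨ cong (λ z → (z xor parityℕ i) xor (parity b xor parityℕ j)) parity-corner ⟩
  (parity b xor parityℕ i) xor (parity b xor parityℕ j)
    ≡⟨ xor-cancel-common (parity b) (parityℕ i) (parityℕ j) ⟩
  parityℕ i xor parityℕ j ∎
  where
  open ≡-Reasoning
  parity-shift : ∀ x i → parity (shift x i) ≡ parity x xor parityℕ i
  parity-shift x i = trans (cong parity (shift≡+ x i)) (parity-+ℕ x i)
  parity-corner : parity (cornerX (a , b)) ≡ parity b
  parity-corner = trans (cong parity (cornerX-≡ a b))
                        (trans (parity-+ (+ 2 * a) b) (cong (_xor parity b) (parity-2* a)))

cornerX-injective : ∀ {c c'} → cornerX c ≡ cornerX c' → proj₂ c ≡ proj₂ c' → c ≡ c'
cornerX-injective {a , b} {a' , .b} eq refl = cong (_, b)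
  (ℤ.*-cancelˡ-≡ (+ 2) a a' (ℤ+.∙-cancelʳ b (+ 2 * a) (+ 2 * a')
    (trans (sym (cornerX-≡ a b)) (trans eq (cornerX-≡ a' b)))))

edgeColour : Fin 6 → Bool
edgeColour p = parityℕ (edgeDx p) xor parityℕ (edgeDy p)

-- The colour condition excludes the translates of a cell by vectors (dx , dy) with dx + dy odd:
-- such a translate can share two edges with the cell but is not a cell itself, since every
-- cell corner (2a + b , b) has an even coordinate sum.
common-edge-positions : ∀ p q p' q' →
  edgeDir p ≡ edgeDir q → edgeDir p' ≡ edgeDir q' →
  edgeDx p ℕ.+ edgeDx q' ≡ edgeDx q ℕ.+ edgeDx p' → edgeDy p ℕ.+ edgeDy q' ≡ edgeDy q ℕ.+ edgeDy p' →
  edgeColour p ≡ edgeColour q → p ≡ q ⊎ p ≡ p'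
common-edge-positions = from-yes (all? λ p → all? λ q → all? λ p' → all? λ q' →
  edgeDir p ≟ᴰ edgeDir q →-dec edgeDir p' ≟ᴰ edgeDir q' →-dec
  edgeDx p ℕ.+ edgeDx q' ℕ.≟ edgeDx q ℕ.+ edgeDx p' →-dec
  edgeDy p ℕ.+ edgeDy q' ℕ.≟ edgeDy q ℕ.+ edgeDy p' →-dec
  edgeColour p ≟ᵇ edgeColour q →-dec (p Fin.≟ q ⊎-dec p Fin.≟ p'))

hexEdge-pairs⇒≡ : ∀ {c c'} p q p' q' → hexEdge c p ≡ hexEdge c' q → hexEdge c p' ≡ hexEdge c' q' →
                  p ≢ p' → c ≡ c'
hexEdge-pairs⇒≡ {c} {c'} p q p' q' eq eq' p≢p' = conclude (common-edge-positions p q p' q'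
  (cong proj₁ eq) (cong proj₁ eq')
  (shift-difference (edgeDx p) (edgeDx q) (edgeDx p') (edgeDx q') (xs eq) (xs eq'))
  (shift-difference (edgeDy p) (edgeDy q) (edgeDy p') (edgeDy q') (ys eq) (ys eq'))
  (trans (sym (colour-latticeVertex c (edgeDx p) (edgeDy p)))
         (trans (cong (colour ∘ proj₂) eq) (colour-latticeVertex c' (edgeDx q) (edgeDy q)))))
  where
  xs : ∀ {r s} → hexEdge c r ≡ hexEdge c' s → shift (cornerX c) (edgeDx r) ≡ shift (cornerX c') (edgeDx s)
  xs = cong (proj₁ ∘ proj₂)
  ys : ∀ {r s} → hexEdge c r ≡ hexEdge c' s → shift (proj₂ c) (edgeDy r) ≡ shift (proj₂ c') (edgeDy s)
  ys = cong (proj₂ ∘ proj₂)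
  conclude : p ≡ q ⊎ p ≡ p' → c ≡ c'
  conclude (inj₁ refl)  = cornerX-injective (shift-injectiveˡ (edgeDx p) (xs eq)) (shift-injectiveˡ (edgeDy p) (ys eq))
  conclude (inj₂ p≡p') = contradiction p≡p' p≢p'

two-common-edges⇒≡ : ∀ {c c' e e'} → e ≢ e' → e ∈ hexEdges c → e' ∈ hexEdges c →
                     e ∈ hexEdges c' → e' ∈ hexEdges c' → c ≡ c'
two-common-edges⇒≡ {c} {c'} e≢e' e∈c e'∈c e∈c' e'∈c'
  with ∈-hexEdges⁻ c e∈c | ∈-hexEdges⁻ c e'∈c | ∈-hexEdges⁻ c' e∈c' | ∈-hexEdges⁻ c' e'∈c'
... | p , refl | p' , refl | q , eq | q' , eq' = hexEdge-pairs⇒≡ p q p' q' eq eq' (e≢e' ∘ cong (hexEdge c))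

hexEdge-≢ : ∀ c {p q} → p ≢ q → hexEdge c p ≢ hexEdge c q
hexEdge-≢ c p≢q = p≢q ∘ hexEdge-injective c

-- Alternating hexagons and perfect matchings

_≟ⱽ_ : DecidableEquality Vertex
_≟ⱽ_ = Product.≡-dec ℤ._≟_ ℤ._≟_

_≟ᴱ_ : DecidableEquality LEdge
_≟ᴱ_ = Product.≡-dec _≟ᴰ_ _≟ⱽ_

_≟ᶜ_ : DecidableEquality Cell
_≟ᶜ_ = Product.≡-dec ℤ._≟_ ℤ._≟_

module ∈ᴱ = DecMembership _≟ᴱ_
module ∈ⱽ = DecMembership _≟ⱽ_

opaque
  hexSet : Cell → EdgeSet
  hexSet c e = does (e ∈ᴱ.∈? hexEdges c)

  hexSet-∈ : ∀ {c e} → e ∈ hexEdges c → hexSet c e ≡ true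
  hexSet-∈ {c} {e} = dec-true (e ∈ᴱ.∈? hexEdges c)

  hexSet-∉ : ∀ {c e} → e ∉ hexEdges c → hexSet c e ≡ false
  hexSet-∉ {c} {e} = dec-false (e ∈ᴱ.∈? hexEdges c)

  hexSet-true⁻ : ∀ {c e} → hexSet c e ≡ true → e ∈ hexEdges c
  hexSet-true⁻ {c} {e} = witness (e ∈ᴱ.∈? hexEdges c)
    where
    witness : ∀ {A : Set} (a? : Dec A) → does a? ≡ true → A
    witness (yes a) _ = a

hexSet-hexEdge : ∀ c p → hexSet c (hexEdge c p) ≡ true
hexSet-hexEdge c p = hexSet-∈ (hexEdge-∈ c p)

record Alternates (M : EdgeSet) (c : Cell) : Set where
  constructor alternates
  field flips : ∀ p → M (hexEdge c (nxt p)) ≡ not (M (hexEdge c p))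
open Alternates public

Alternating⇒Alternates : ∀ M c → Alternating M c → Alternates M c
Alternating⇒Alternates M c alt = from (subst (λ A → A) (Alternating-≡ M c) alt)
  where
  next : ∀ {a b : Bool} → a ≢ b → b ≡ not a
  next a≢b = ¬-not (a≢b ∘ sym)
  from : _ → Alternates M c
  from (a₀ , a₁ , a₂ , a₃ , a₄ , a₅) = alternates λ where
    f0 → next a₀
    f1 → next a₁
    f2 → next a₂
    f3 → next a₃
    f4 → next a₄
    f5 → next a₅

Alternates⇒Alternating : ∀ M c → Alternates M c → Alternating M c
Alternates⇒Alternating M c alt = subst (λ A → A) (sym (Alternating-≡ M c))
  (differ f0 , differ f1 , differ f2 , differ f3 , differ f4 , differ f5)
  where
  differ : ∀ p → M (hexEdge c p) ≢ M (hexEdge c (nxt p))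
  differ p eq = not-¬ (sym eq) (flips alt p)

alternates-prev : ∀ {M c} → Alternates M c → ∀ k → M (hexEdge c k) ≡ not (M (hexEdge c (prev k)))
alternates-prev {M} {c} alt k =
  subst (λ j → M (hexEdge c j) ≡ not (M (hexEdge c (prev k)))) (nxt-prev k) (flips alt (prev k))

alternates-step : ∀ {M c} → Alternates M c → ∀ p →
                  M (hexEdge c p) ≡ M (hexEdge c f0) xor oddPosition p →
                  M (hexEdge c (nxt p)) ≡ M (hexEdge c f0) xor oddPosition (nxt p)
alternates-step {M} {c} alt p eq = begin
  M (hexEdge c (nxt p))                     ≡⟨ flips alt p ⟩
  not (M (hexEdge c p))                     ≡⟨ cong not eq ⟩
  not (M (hexEdge c f0) xor oddPosition p)  ≡⟨ not-distribʳ-xor (M (hexEdge c f0)) (oddPosition p) ⟩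
  M (hexEdge c f0) xor not (oddPosition p)  ≡⟨ cong (M (hexEdge c f0) xor_) (oddPosition-nxt p) ⟨
  M (hexEdge c f0) xor oddPosition (nxt p)  ∎
  where open ≡-Reasoning

alternates⇒value : ∀ {M c} → Alternates M c → ∀ p → M (hexEdge c p) ≡ M (hexEdge c f0) xor oddPosition p
alternates⇒value {M} {c} alt = values
  where
  v₀ = sym (xor-identityʳ (M (hexEdge c f0)))
  v₁ = alternates-step alt f0 v₀
  v₂ = alternates-step alt f1 v₁
  v₃ = alternates-step alt f2 v₂
  v₄ = alternates-step alt f3 v₃
  values : ∀ p → M (hexEdge c p) ≡ M (hexEdge c f0) xor oddPosition p
  values f0 = v₀
  values f1 = v₁
  values f2 = v₂
  values f3 = v₃
  values f4 = v₄
  values f5 = alternates-step alt f4 v₄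

value⇒alternates : ∀ {M c} b → (∀ p → M (hexEdge c p) ≡ b xor oddPosition p) → Alternates M c
value⇒alternates {M} {c} b val = alternates λ p → begin
  M (hexEdge c (nxt p))         ≡⟨ val (nxt p) ⟩
  b xor oddPosition (nxt p)     ≡⟨ cong (b xor_) (oddPosition-nxt p) ⟩
  b xor not (oddPosition p)     ≡⟨ not-distribʳ-xor b (oddPosition p) ⟨
  not (b xor oddPosition p)     ≡⟨ cong not (val p) ⟨
  not (M (hexEdge c p))         ∎
  where open ≡-Reasoning

alternates-xor : ∀ {M N c} b → Alternates M c → (∀ p → N (hexEdge c p) ≡ M (hexEdge c p) xor b) →
                 Alternates N c
alternates-xor {M} {N} {c} b alt eq = value⇒alternates (M (hexEdge c f0) xor b) λ p → begin
  N (hexEdge c p)                             ≡⟨ eq p ⟩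
  M (hexEdge c p) xor b                       ≡⟨ cong (_xor b) (alternates⇒value alt p) ⟩
  (M (hexEdge c f0) xor oddPosition p) xor b  ≡⟨ xor-assoc (M (hexEdge c f0)) (oddPosition p) b ⟩
  M (hexEdge c f0) xor (oddPosition p xor b)  ≡⟨ cong (M (hexEdge c f0) xor_) (xor-comm (oddPosition p) b) ⟩
  M (hexEdge c f0) xor (b xor oddPosition p)  ≡⟨ xor-assoc (M (hexEdge c f0)) b (oddPosition p) ⟨
  (M (hexEdge c f0) xor b) xor oddPosition p  ∎
  where open ≡-Reasoning

alternates-difference : ∀ {M N c} → Alternates M c → Alternates N c → ∀ p →
                        N (hexEdge c p) ≡ M (hexEdge c p) xor (N (hexEdge c f0) xor M (hexEdge c f0))
alternates-difference {M} {N} {c} altM altN p = begin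
  N (hexEdge c p)                         ≡⟨ alternates⇒value altN p ⟩
  n₀ xor oddPosition p                    ≡⟨ xor-cancel-common m₀ n₀ (oddPosition p) ⟨
  (m₀ xor n₀) xor (m₀ xor oddPosition p)  ≡⟨ xor-comm (m₀ xor n₀) _ ⟩
  (m₀ xor oddPosition p) xor (m₀ xor n₀)  ≡⟨ cong₂ _xor_ (alternates⇒value altM p) (xor-comm n₀ m₀) ⟨
  M (hexEdge c p) xor (n₀ xor m₀)         ∎
  where
  open ≡-Reasoning
  m₀ = M (hexEdge c f0)
  n₀ = N (hexEdge c f0)

resonance⇔hexSet : ∀ {M M' : EdgeSet} {c} →
  (∀ e → (M e xor M' e ≡ true) ⇔ e ∈ hexEdges c) ⇔ (∀ e → M e xor M' e ≡ hexSet c e)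
resonance⇔hexSet {M} {M'} {c} = mk⇔ to from
  where
  to : (∀ e → (M e xor M' e ≡ true) ⇔ e ∈ hexEdges c) → ∀ e → M e xor M' e ≡ hexSet c e
  to r e with M e xor M' e in eq
  ... | true  = sym (hexSet-∈ (Equivalence.to (r e) eq))
  ... | false = sym (hexSet-∉ λ e∈ → case trans (sym eq) (Equivalence.from (r e) e∈) of λ ())
  from : (∀ e → M e xor M' e ≡ hexSet c e) → ∀ e → (M e xor M' e ≡ true) ⇔ e ∈ hexEdges c
  from eq e = mk⇔ (λ t → hexSet-true⁻ (trans (sym (eq e)) t)) (λ e∈ → trans (eq e) (hexSet-∈ e∈))

MatchedOnce : EdgeSet → Vertex → Set
MatchedOnce M v =
  (∃[ e ] (e ∈ₑ M × Incident e v)) ×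
  (∀ e e' → e ∈ₑ M → e' ∈ₑ M → Incident e v → Incident e' v → e ≡ e')

matchedOnce-resp : ∀ {M N v} → MatchedOnce N v → (∀ e → Incident e v → M e ≡ N e) → MatchedOnce M v
matchedOnce-resp ((e , e∈N , inc) , unique) agree =
  (e , trans (agree e inc) e∈N , inc) ,
  λ e e' e∈ e'∈ inc inc' → unique e e' (trans (sym (agree e inc)) e∈) (trans (sym (agree e' inc')) e'∈) inc inc'

alternating-matchedOnce : ∀ {M c} k → Alternates M c →
  (∀ {e} → M e ≡ true → Incident e (hexVertex c k) → e ∈ hexEdges c) → MatchedOnce M (hexVertex c k)
alternating-matchedOnce {M} {c} k alt local = exists , unique
  where
  not-equal : M (hexEdge c k) ≢ M (hexEdge c (prev k))
  not-equal eq = not-¬ eq (alternates-prev alt k)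

  exists : ∃[ e ] (M e ≡ true × Incident e (hexVertex c k))
  exists with M (hexEdge c k) in eq
  ... | true  = hexEdge c k , eq , incident-self c k
  ... | false = hexEdge c (prev k) , ¬-not (λ eq' → not-equal (trans eq (sym eq'))) , incident-prev c k

  position : ∀ {e} → M e ≡ true → Incident e (hexVertex c k) →
             ∃[ p ] (e ≡ hexEdge c p × (p ≡ k ⊎ p ≡ prev k))
  position e∈ inc with ∈-hexEdges⁻ c (local e∈ inc)
  ... | p , refl = p , refl , incident-position c p k inc

  unique : ∀ e e' → M e ≡ true → M e' ≡ true →
           Incident e (hexVertex c k) → Incident e' (hexVertex c k) → e ≡ e'
  unique e e' e∈ e'∈ inc inc' with position e∈ inc | position e'∈ inc'
  ... | p , refl , inj₁ refl | p' , refl , inj₁ refl = refl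
  ... | p , refl , inj₂ refl | p' , refl , inj₂ refl = refl
  ... | p , refl , inj₁ refl | p' , refl , inj₂ refl = ⊥-elim (not-equal (trans e∈ (sym e'∈)))
  ... | p , refl , inj₂ refl | p' , refl , inj₁ refl = ⊥-elim (not-equal (trans e'∈ (sym e∈)))

module Matchings (H : HexSystem) where

  IsPM : EdgeSet → Set
  IsPM = IsPerfectMatching H

  matched-unique : ∀ {M v e e'} → IsPM M → v ∈V cells H → e ∈ₑ M → e' ∈ₑ M →
                   Incident e v → Incident e' v → e ≡ e'
  matched-unique pm v∈ = proj₂ (proj₂ pm _ v∈) _ _

  matched-exists : ∀ {M v} → IsPM M → v ∈V cells H → ∃[ e ] (e ∈ₑ M × Incident e v)
  matched-exists pm v∈ = proj₁ (proj₂ pm _ v∈)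

  hexVertex-∈V : ∀ {c} → c ∈ cells H → ∀ k → hexVertex c k ∈V cells H
  hexVertex-∈V {c} c∈ k = c , c∈ , hexVertex-∈ c k

  endpoint-∈V : ∀ {e v} → e ∈E cells H → Incident e v → v ∈V cells H
  endpoint-∈V (c , c∈ , e∈) inc = c , c∈ , endpoint-∈-hexVerts c e∈ inc

  alternating-matched-edge : ∀ {M c} → IsPM M → c ∈ cells H → Alternates M c → ∀ k {e} → e ∈ₑ M →
                             Incident e (hexVertex c k) → e ≡ hexEdge c k ⊎ e ≡ hexEdge c (prev k)
  alternating-matched-edge {M} {c} pm c∈ alt k e∈ inc with M (hexEdge c k) in eq
  ... | true  = inj₁ (matched-unique pm (hexVertex-∈V c∈ k) e∈ eq inc (incident-self c k))
  ... | false = inj₂ (matched-unique pm (hexVertex-∈V c∈ k) e∈ prev∈ inc (incident-prev c k))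
    where
    prev∈ : M (hexEdge c (prev k)) ≡ true
    prev∈ = trans (sym (not-involutive _)) (cong not (trans (sym (alternates-prev alt k)) eq))

  alternating-matched-edge-∈ : ∀ {M c v e} → IsPM M → c ∈ cells H → Alternates M c → v ∈ hexVerts c →
                               e ∈ₑ M → Incident e v → e ∈ hexEdges c
  alternating-matched-edge-∈ {c = c} pm c∈ alt v∈ e∈ inc with ∈-hexVerts⁻ c v∈
  ... | k , refl with alternating-matched-edge pm c∈ alt k e∈ inc
  ... | inj₁ refl = hexEdge-∈ c k
  ... | inj₂ refl = hexEdge-∈ c (prev k)

  flipHex : EdgeSet → Cell → EdgeSet
  flipHex M c e = M e xor hexSet c e

  flipHex-isPM : ∀ {M c} → IsPM M → c ∈ cells H → Alternates M c → IsPM (flipHex M c)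
  flipHex-isPM {M} {c} pm c∈ alt = edges , vertices
    where
    edges : ∀ e → flipHex M c e ≡ true → e ∈E cells H
    edges e t with hexSet c e in h
    ... | true  = c , c∈ , hexSet-true⁻ h
    ... | false = proj₁ pm e (trans (sym (xor-identityʳ (M e))) t)

    flipped-∈ : ∀ k {e} → flipHex M c e ≡ true → Incident e (hexVertex c k) → e ∈ hexEdges c
    flipped-∈ k {e} t inc with hexSet c e in h
    ... | true  = hexSet-true⁻ h
    ... | false = alternating-matched-edge-∈ pm c∈ alt (hexVertex-∈ c k) (trans (sym (xor-identityʳ (M e))) t) inc

    vertices : ∀ v → v ∈V cells H → MatchedOnce (flipHex M c) v
    vertices v v∈ with v ∈ⱽ.∈? hexVerts c
    ... | no v∉ = matchedOnce-resp (proj₂ pm v v∈) λ e inc →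
          trans (cong (M e xor_) (hexSet-∉ λ e∈ → v∉ (endpoint-∈-hexVerts c e∈ inc))) (xor-identityʳ (M e))
    ... | yes v∈c with ∈-hexVerts⁻ c v∈c
    ... | k , refl = alternating-matchedOnce k
          (alternates-xor true alt λ p → cong (M (hexEdge c p) xor_) (hexSet-hexEdge c p)) (flipped-∈ k)

  resonance⇒alternates : ∀ {M M' c} → IsPM M → IsPM M' → c ∈ cells H →
                         (∀ e → M e xor M' e ≡ hexSet c e) → Alternates M c
  resonance⇒alternates {M} {M'} {c} pm pm' c∈ diff = alternates λ p → ¬-not (differ p)
    where
    complement : ∀ p → M' (hexEdge c p) ≡ not (M (hexEdge c p))
    complement p = trans (xor-solveˡ (M (hexEdge c p)) (trans (diff _) (hexSet-hexEdge c p))) (xor-trueʳ _)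

    consecutive : ∀ {N} → IsPM N → ∀ p → N (hexEdge c p) ≡ true → N (hexEdge c (nxt p)) ≡ true → ⊥
    consecutive pm p e∈ e'∈ = prev-≢ (nxt p) (trans (prev-nxt p) (hexEdge-injective c
      (matched-unique pm (hexVertex-∈V c∈ (nxt p)) e∈ e'∈
        (subst (λ j → Incident (hexEdge c j) (hexVertex c (nxt p))) (prev-nxt p) (incident-prev c (nxt p)))
        (incident-self c (nxt p)))))

    differ : ∀ p → M (hexEdge c (nxt p)) ≢ M (hexEdge c p)
    differ p eq with M (hexEdge c p) in ep
    ... | true  = consecutive pm p ep eq
    ... | false = consecutive pm' p (trans (complement p) (cong not ep)) (trans (complement (nxt p)) (cong not eq))

-- Hypercubes

lookup-extensionality : ∀ {n} {A : Set} {x y : Vec A n} → (∀ i → lookup x i ≡ lookup y i) → x ≡ y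
lookup-extensionality {x = x} {y} eq = trans (sym (tabulate∘lookup x)) (trans (tabulate-cong eq) (tabulate∘lookup y))

DiffersAt : ∀ {n} → Vec Bool n → Vec Bool n → Fin n → Set
DiffersAt x y i = lookup x i ≢ lookup y i

UniqueDifference : ∀ {n} → Vec Bool n → Vec Bool n → Fin n → Set
UniqueDifference x y i = DiffersAt x y i × (∀ j → DiffersAt x y j → j ≡ i)

agrees-off-difference : ∀ {n} (x y : Vec Bool n) {i} j → (∀ j → DiffersAt x y j → j ≡ i) → j ≢ i →
                        lookup x j ≡ lookup y j
agrees-off-difference x y j unique j≢i = decidable-stable (lookup x j ≟ᵇ lookup y j) (j≢i ∘ unique j)

hamming≡0⇒≡ : ∀ {n} (x y : Vec Bool n) → hamming x y ≡ 0 → ∀ i → lookup x i ≡ lookup y i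
hamming≡0⇒≡ (true  ∷ x) (true  ∷ y) h zero    = refl
hamming≡0⇒≡ (false ∷ x) (false ∷ y) h zero    = refl
hamming≡0⇒≡ (true  ∷ x) (true  ∷ y) h (suc i) = hamming≡0⇒≡ x y h i
hamming≡0⇒≡ (false ∷ x) (false ∷ y) h (suc i) = hamming≡0⇒≡ x y h i

≡⇒hamming≡0 : ∀ {n} (x y : Vec Bool n) → (∀ i → lookup x i ≡ lookup y i) → hamming x y ≡ 0
≡⇒hamming≡0 []          []          eq = refl
≡⇒hamming≡0 (true  ∷ x) (true  ∷ y) eq = ≡⇒hamming≡0 x y (eq ∘ suc)
≡⇒hamming≡0 (false ∷ x) (false ∷ y) eq = ≡⇒hamming≡0 x y (eq ∘ suc)
≡⇒hamming≡0 (true  ∷ x) (false ∷ y) eq with () ← eq zero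
≡⇒hamming≡0 (false ∷ x) (true  ∷ y) eq with () ← eq zero

uniqueDifference-∷ : ∀ {n} {x y : Vec Bool n} b → ∃[ i ] UniqueDifference x y i →
                     ∃[ i ] UniqueDifference (b ∷ x) (b ∷ y) i
uniqueDifference-∷ b (i , d , u) =
  suc i , d , λ { zero d' → contradiction refl d' ; (suc j) d' → cong suc (u j d') }

hamming≡1⇒ : ∀ {n} (x y : Vec Bool n) → hamming x y ≡ 1 → ∃[ i ] UniqueDifference x y i
hamming≡1⇒ []          []          ()
hamming≡1⇒ (true  ∷ x) (true  ∷ y) h = uniqueDifference-∷ true (hamming≡1⇒ x y h)
hamming≡1⇒ (false ∷ x) (false ∷ y) h = uniqueDifference-∷ false (hamming≡1⇒ x y h)
hamming≡1⇒ (true  ∷ x) (false ∷ y) h =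
  zero , (λ ()) , λ { zero _ → refl ; (suc j) d' → contradiction (hamming≡0⇒≡ x y (ℕ.suc-injective h) j) d' }
hamming≡1⇒ (false ∷ x) (true  ∷ y) h =
  zero , (λ ()) , λ { zero _ → refl ; (suc j) d' → contradiction (hamming≡0⇒≡ x y (ℕ.suc-injective h) j) d' }

⇒hamming≡1 : ∀ {n} (x y : Vec Bool n) i → UniqueDifference x y i → hamming x y ≡ 1
⇒hamming≡1 (true  ∷ x) (true  ∷ y) zero (d , u) = contradiction refl d
⇒hamming≡1 (false ∷ x) (false ∷ y) zero (d , u) = contradiction refl d
⇒hamming≡1 (true  ∷ x) (false ∷ y) zero (d , u) =
  cong suc (≡⇒hamming≡0 x y λ j → agrees-off-difference (true ∷ x) (false ∷ y) (suc j) u λ ())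
⇒hamming≡1 (false ∷ x) (true  ∷ y) zero (d , u) =
  cong suc (≡⇒hamming≡0 x y λ j → agrees-off-difference (false ∷ x) (true ∷ y) (suc j) u λ ())
⇒hamming≡1 (true  ∷ x) (true  ∷ y) (suc i) (d , u) = ⇒hamming≡1 x y i (d , Fin.suc-injective ∘₂ u ∘ suc)
⇒hamming≡1 (false ∷ x) (false ∷ y) (suc i) (d , u) = ⇒hamming≡1 x y i (d , Fin.suc-injective ∘₂ u ∘ suc)
⇒hamming≡1 (true  ∷ x) (false ∷ y) (suc i) (d , u) with () ← u zero (λ ())
⇒hamming≡1 (false ∷ x) (true  ∷ y) (suc i) (d , u) with () ← u zero (λ ())

set-hamming≡1 : ∀ {n} (x : Vec Bool n) i → lookup x i ≡ false → hamming x (x [ i ]≔ true) ≡ 1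
set-hamming≡1 x i xᵢ = ⇒hamming≡1 x (x [ i ]≔ true) i (differs , only-i)
  where
  differs : DiffersAt x (x [ i ]≔ true) i
  differs eq = case trans (sym xᵢ) (trans eq (lookup∘update i x true)) of λ ()
  only-i : ∀ j → DiffersAt x (x [ i ]≔ true) j → j ≡ i
  only-i j d with j Fin.≟ i
  ... | yes j≡i = j≡i
  ... | no  j≢i = contradiction (sym (lookup∘update′ j≢i x true)) d

weight : ∀ {n} → Vec Bool n → ℕ
weight []          = 0
weight (true  ∷ x) = suc (weight x)
weight (false ∷ x) = weight x

weight-clear : ∀ {n} (x : Vec Bool n) i → lookup x i ≡ true → weight x ≡ suc (weight (x [ i ]≔ false))
weight-clear (true  ∷ x) zero    refl = refl
weight-clear (true  ∷ x) (suc i) eq   = cong suc (weight-clear x i eq)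
weight-clear (false ∷ x) (suc i) eq   = weight-clear x i eq

bool-vector-induction : ∀ {n} (P : Vec Bool n → Set) → P (replicate n false) →
                        (∀ y i → lookup y i ≡ false → P y → P (y [ i ]≔ true)) → ∀ x → P x
bool-vector-induction {n} P base extend x = go (weight x) x refl
  where
  go : ∀ w x → weight x ≡ w → P x
  go w x eq with any? (λ i → lookup x i ≟ᵇ true)
  ... | no none = subst P (sym (lookup-extensionality λ i →
                    trans (¬-not λ t → none (i , t)) (sym (lookup-replicate i false)))) base
  ... | yes (i , xᵢ) with w | trans (sym (weight-clear x i xᵢ)) eq
  ... | suc w | eq' = subst P restored
                        (extend (x [ i ]≔ false) i (lookup∘update i x false) (go w _ (ℕ.suc-injective eq')))
    where
    restored : (x [ i ]≔ false) [ i ]≔ true ≡ x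
    restored = trans ([]≔-idempotent x i) (trans (cong (x [ i ]≔_) (sym xᵢ)) ([]≔-lookup x i))

hexSum : ∀ {n} → Vec Bool n → (Fin n → Cell) → EdgeSet
hexSum []      h e = false
hexSum (b ∷ x) h e = (b ∧ hexSet (h zero) e) xor hexSum x (h ∘ suc) e

hexSum-outside : ∀ {n} (x : Vec Bool n) h {e} → (∀ i → hexSet (h i) e ≡ false) → hexSum x h e ≡ false
hexSum-outside []      h out = refl
hexSum-outside (b ∷ x) h out rewrite out zero | ∧-zeroʳ b = hexSum-outside x (h ∘ suc) (out ∘ suc)

hexSum-inside : ∀ {n} (x : Vec Bool n) h {e} i → hexSet (h i) e ≡ true →
                (∀ j → j ≢ i → hexSet (h j) e ≡ false) → hexSum x h e ≡ lookup x i
hexSum-inside (b ∷ x) h zero in₀ out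
  rewrite in₀ | ∧-identityʳ b | hexSum-outside x (h ∘ suc) (λ j → out (suc j) λ ()) = xor-identityʳ b
hexSum-inside (b ∷ x) h (suc i) inᵢ out
  rewrite out zero (λ ()) | ∧-zeroʳ b =
    hexSum-inside x (h ∘ suc) i inᵢ λ j j≢i → out (suc j) (j≢i ∘ Fin.suc-injective)

hexSum-update : ∀ {n} (x : Vec Bool n) h e i → lookup x i ≡ false →
                hexSum (x [ i ]≔ true) h e ≡ hexSum x h e xor hexSet (h i) e
hexSum-update (b ∷ x) h e zero    refl = xor-comm (hexSet (h zero) e) (hexSum x (h ∘ suc) e)
hexSum-update (b ∷ x) h e (suc i) xᵢ rewrite hexSum-update x (h ∘ suc) e i xᵢ =
  sym (xor-assoc (b ∧ hexSet (h zero) e) (hexSum x (h ∘ suc) e) (hexSet (h (suc i)) e))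

hexSum-zero : ∀ {n} (h : Fin n → Cell) e → hexSum (replicate n false) h e ≡ false
hexSum-zero {zero}  h e = refl
hexSum-zero {suc n} h e = hexSum-zero (h ∘ suc) e

-- Clar covers

Full : EdgeSet → Cell → Set
Full C c = ∀ p → C (hexEdge c p) ≡ true

full-hexComp-≡ : ∀ {C c c'} k → Full C c → HexComp C c' → hexVertex c k ∈ hexVerts c' → c ≡ c'
full-hexComp-≡ {C} {c} {c'} k full (_ , closed) k∈ =
  two-common-edges⇒≡ (hexEdge-≢ c (prev-≢ k ∘ sym)) (hexEdge-∈ c k) (hexEdge-∈ c (prev k))
    (closed _ _ (full k) k∈ (incident-self c k)) (closed _ _ (full (prev k)) k∈ (incident-prev c k))

edgeComp-∉-full : ∀ {C c e} → Full C c → EdgeComp C e → e ∉ hexEdges c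
edgeComp-∉-full {C} {c} full (_ , alone) e∈ with ∈-hexEdges⁻ c e∈
... | p , refl = hexEdge-≢ c (prev-≢ (src p) ∘ sym) (trans (at (src p) (incident-self c (src p)))
                                                         (sym (at (prev (src p)) (incident-prev c (src p)))))
  where
  at : ∀ q → Incident (hexEdge c q) (hexVertex c (src p)) → hexEdge c q ≡ hexEdge c p
  at q inc = alone _ _ (full q) (endpoint⇒incident c p (src p) (inj₁ refl)) inc

hexComp-resp : ∀ {C C' c} → C ≗ C' → HexComp C c → HexComp C' c
hexComp-resp C≗C' (all-in , closed) = (λ e e∈ → trans (sym (C≗C' e)) (all-in e e∈)) ,
                                      λ e v e∈C' → closed e v (trans (C≗C' e) e∈C')

edgeComp-resp : ∀ {C C' e} → C ≗ C' → EdgeComp C e → EdgeComp C' e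
edgeComp-resp {e = e} C≗C' (e∈ , alone) =
  trans (sym (C≗C' e)) e∈ , λ e' v e'∈C' → alone e' v (trans (C≗C' e') e'∈C')

module ClarCovers (H : HexSystem) where
  open Matchings H

  inF-resp : ∀ {C C' : ClarCover H} {M} → _≈C_ {H} C C' → InF {H} C M → InF {H} C' M
  inF-resp C≈C' (alt , matched) = (λ c c∈ hc → alt c c∈ (hexComp-resp {c = c} (λ e → sym (C≈C' e)) hc)) ,
                                  (λ e ec → matched e (edgeComp-resp {e = e} (λ e → sym (C≈C' e)) ec))

  inF-respᴹ : ∀ {C : ClarCover H} {M M'} → _≈M_ {H} M M' → InF {H} C M → InF {H} C M'
  inF-respᴹ {M = M} {M'} M≈M' (alt , matched) =
    (λ c c∈ hc → Alternates⇒Alternating (proj₁ M') c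
       (alternates-xor false (Alternating⇒Alternates (proj₁ M) c (alt c c∈ hc))
         λ p → trans (sym (M≈M' _)) (sym (xor-identityʳ _)))) ,
    (λ e ec → trans (sym (M≈M' e)) (matched e ec))

  full⇒hexComp : ∀ {C c} → IsClarCover H C → c ∈ cells H → Full C c → HexComp C c
  full⇒hexComp {C} {c} (_ , components) c∈ full = all-in , closed
    where
    all-in : ∀ e → e ∈ hexEdges c → e ∈ₑ C
    all-in e e∈ with ∈-hexEdges⁻ c e∈
    ... | p , refl = full p
    closed : ∀ e v → e ∈ₑ C → v ∈ hexVerts c → Incident e v → e ∈ hexEdges c
    closed e v e∈C v∈ inc with ∈-hexVerts⁻ c v∈ | components v (c , c∈ , v∈)
    ... | k , refl | inj₁ (c' , _ , hc' , k∈) =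
      subst (λ d → e ∈ hexEdges d) (sym (full-hexComp-≡ {C} {c} {c'} k full hc' k∈))
            (proj₂ hc' e (hexVertex c k) e∈C k∈ inc)
    ... | k , refl | inj₂ (e₀ , ec , inc₀) = contradiction
          (subst (_∈ hexEdges c) (proj₂ ec _ _ (full k) inc₀ (incident-self c k)) (hexEdge-∈ c k))
          (edgeComp-∉-full {C} {c} full ec)

  inF⇒⊆ : ∀ (C : ClarCover H) M → InF {H} C M → ∀ {e} → proj₁ M e ≡ true → proj₁ C e ≡ true
  inF⇒⊆ C (M , pm) (alternating , matched) {e} e∈M = by-component (proj₂ (proj₂ C) _ v∈)
    where
    v∈ = endpoint-∈V (proj₁ pm e e∈M) (inj₁ refl)
    by-component : _ → proj₁ C e ≡ true
    by-component (inj₁ (c , c∈ , hc , v∈c)) = proj₁ hc e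
      (alternating-matched-edge-∈ pm c∈ (Alternating⇒Alternates M c (alternating c c∈ hc)) v∈c e∈M (inj₁ refl))
    by-component (inj₂ (e₀ , ec , inc)) =
      subst (λ d → proj₁ C d ≡ true) (matched-unique pm v∈ (matched e₀ ec) e∈M inc (inj₁ refl)) (proj₁ ec)
Disjoint : Cell → Cell → Set
Disjoint c c' = ∀ {v} → v ∈ hexVerts c → v ∉ hexVerts c'

disjoint⇒shared-vertex-≡ : ∀ {n} {h : Fin n → Cell} → (∀ {i j} → i ≢ j → Disjoint (h i) (h j)) →
                           ∀ {i j v} → v ∈ hexVerts (h i) → v ∈ hexVerts (h j) → i ≡ j
disjoint⇒shared-vertex-≡ disjoint {i} {j} v∈ v∈' with i Fin.≟ j
... | yes i≡j = i≡j
... | no  i≢j = contradiction v∈' (disjoint i≢j v∈)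

-- The cube spanned by disjoint M₀-alternating hexagons h i: rotate x switches M₀ around the
-- hexagons with x i = true, and cover is the Clar cover formed by the h i and the rest of M₀.
module HexagonCube (H : HexSystem) {n : ℕ} (M₀ : EdgeSet) (pm₀ : IsPerfectMatching H M₀) (h : Fin n → Cell)
                   (h∈ : ∀ i → h i ∈ cells H) (alt₀ : ∀ i → Alternates M₀ (h i))
                   (disjoint : ∀ {i j} → i ≢ j → Disjoint (h i) (h j)) where
  open Matchings H
  open ClarCovers H

  same-hexagon : ∀ {i j v} → v ∈ hexVerts (h i) → v ∈ hexVerts (h j) → i ≡ j
  same-hexagon = disjoint⇒shared-vertex-≡ {h = h} disjoint

  hexSet-other : ∀ {i e} → e ∈ hexEdges (h i) → ∀ j → j ≢ i → hexSet (h j) e ≡ false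
  hexSet-other {i} e∈ j j≢i = hexSet-∉ λ e∈' →
    disjoint j≢i (endpoint-∈-hexVerts (h j) e∈' (inj₁ refl)) (endpoint-∈-hexVerts (h i) e∈ (inj₁ refl))

  OnHexagon : LEdge → Set
  OnHexagon e = ∃[ i ] e ∈ hexEdges (h i)

  opaque
    onHexagon? : ∀ e → Dec (OnHexagon e)
    onHexagon? e = any? λ i → e ∈ᴱ.∈? hexEdges (h i)

  hexSet-off : ∀ {e} → ¬ OnHexagon e → ∀ i → hexSet (h i) e ≡ false
  hexSet-off off i = hexSet-∉ λ e∈ → off (i , e∈)

  rotate : Vec Bool n → EdgeSet
  rotate x e = M₀ e xor hexSum x h e

  rotate-on : ∀ x {i e} → e ∈ hexEdges (h i) → rotate x e ≡ M₀ e xor lookup x i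
  rotate-on x {i} e∈ = cong (M₀ _ xor_) (hexSum-inside x h i (hexSet-∈ e∈) (hexSet-other e∈))

  rotate-off : ∀ x {e} → ¬ OnHexagon e → rotate x e ≡ M₀ e
  rotate-off x {e} off = trans (cong (M₀ e xor_) (hexSum-outside x h (hexSet-off off))) (xor-identityʳ (M₀ e))

  rotate-alternates : ∀ x i → Alternates (rotate x) (h i)
  rotate-alternates x i = alternates-xor (lookup x i) (alt₀ i) λ p → rotate-on x (hexEdge-∈ (h i) p)

  rotate-near : ∀ x {i v e} → v ∈ hexVerts (h i) → Incident e v →
                rotate x e ≡ M₀ e xor (lookup x i ∧ hexSet (h i) e)
  rotate-near x {i} {v} {e} v∈ inc with onHexagon? e
  ... | yes (j , e∈) with same-hexagon (endpoint-∈-hexVerts (h j) e∈ inc) v∈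
  ... | refl = trans (rotate-on x e∈)
                     (cong (M₀ e xor_) (trans (sym (∧-identityʳ _)) (cong (lookup x j ∧_) (sym (hexSet-∈ e∈)))))
  rotate-near x {i} {v} {e} v∈ inc | no off = trans (rotate-off x off) (sym (begin
    M₀ e xor (lookup x i ∧ hexSet (h i) e) ≡⟨ cong (λ b → M₀ e xor (lookup x i ∧ b)) (hexSet-off off i) ⟩
    M₀ e xor (lookup x i ∧ false)          ≡⟨ cong (M₀ e xor_) (∧-zeroʳ (lookup x i)) ⟩
    M₀ e xor false                         ≡⟨ xor-identityʳ (M₀ e) ⟩
    M₀ e                                   ∎))
    where open ≡-Reasoning

  rotate-isPM : ∀ x → IsPM (rotate x)
  rotate-isPM x = edges , vertices
    where
    edges : ∀ e → rotate x e ≡ true → e ∈E cells H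
    edges e t with onHexagon? e
    ... | yes (i , e∈) = h i , h∈ i , e∈
    ... | no off       = proj₁ pm₀ e (trans (sym (rotate-off x off)) t)
    vertices : ∀ v → v ∈V cells H → MatchedOnce (rotate x) v
    vertices v v∈ with any? (λ i → v ∈ⱽ.∈? hexVerts (h i))
    ... | no off = matchedOnce-resp (proj₂ pm₀ v v∈) λ e inc →
          rotate-off x λ (i , e∈) → off (i , endpoint-∈-hexVerts (h i) e∈ inc)
    ... | yes (i , v∈h) with lookup x i in xᵢ
    ... | false = matchedOnce-resp (proj₂ pm₀ v v∈) λ e inc →
          trans (rotate-near x v∈h inc)
                (trans (cong (λ b → M₀ e xor (b ∧ hexSet (h i) e)) xᵢ) (xor-identityʳ (M₀ e)))
    ... | true = matchedOnce-resp (proj₂ (flipHex-isPM pm₀ (h∈ i) (alt₀ i)) v v∈) λ e inc →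
          trans (rotate-near x v∈h inc) (cong (λ b → M₀ e xor (b ∧ hexSet (h i) e)) xᵢ)

  rotatePM : Vec Bool n → PM H
  rotatePM x = rotate x , rotate-isPM x

  rotate-injective : ∀ x y → rotate x ≗ rotate y → x ≡ y
  rotate-injective x y eq = lookup-extensionality λ i → xor-cancelˡ (M₀ (hexEdge (h i) f0))
    (trans (sym (rotate-on x (hexEdge-∈ (h i) f0))) (trans (eq _) (rotate-on y (hexEdge-∈ (h i) f0))))

  rotate-difference-on : ∀ x y {i e} → e ∈ hexEdges (h i) → rotate x e xor rotate y e ≡ lookup x i xor lookup y i
  rotate-difference-on x y {i} {e} e∈ =
    trans (cong₂ _xor_ (rotate-on x e∈) (rotate-on y e∈)) (xor-cancel-common (M₀ e) (lookup x i) (lookup y i))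

  rotate-difference-off : ∀ x y {e} → ¬ OnHexagon e → rotate x e xor rotate y e ≡ false
  rotate-difference-off x y {e} off = xor-≡ (trans (rotate-off x off) (sym (rotate-off y off)))

  cubeAdj⇒resAdj : ∀ x y → CubeAdj x y → ResAdj {H} (rotatePM x) (rotatePM y)
  cubeAdj⇒resAdj x y adj with hamming≡1⇒ x y adj
  ... | i , xᵢ≢yᵢ , unique = h i , h∈ i , Equivalence.from (resonance⇔hexSet {rotate x} {rotate y}) difference
    where
    difference : ∀ e → rotate x e xor rotate y e ≡ hexSet (h i) e
    difference e with onHexagon? e
    ... | no off = trans (rotate-difference-off x y off) (sym (hexSet-off off i))
    ... | yes (j , e∈) with j Fin.≟ i
    ... | yes refl = trans (rotate-difference-on x y e∈) (trans (xor-≢ xᵢ≢yᵢ) (sym (hexSet-∈ e∈)))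
    ... | no j≢i = trans (rotate-difference-on x y e∈) (trans (xor-≡ (agrees-off-difference x y j unique j≢i))
                                                            (sym (hexSet-other e∈ i (j≢i ∘ sym))))

  resAdj⇒cubeAdj : ∀ x y → ResAdj {H} (rotatePM x) (rotatePM y) → CubeAdj x y
  resAdj⇒cubeAdj x y (c , c∈ , r) =
    ⇒hamming≡1 x y (proj₁ differing) (proj₂ differing , λ j d → unique j _ d (proj₂ differing))
    where
    difference : ∀ e → rotate x e xor rotate y e ≡ hexSet c e
    difference = Equivalence.to (resonance⇔hexSet {rotate x} {rotate y}) r
    hexagon-of : ∀ i → DiffersAt x y i → h i ≡ c
    hexagon-of i d =
      two-common-edges⇒≡ (hexEdge-≢ (h i) {f0} {f1} λ ()) (hexEdge-∈ (h i) f0) (hexEdge-∈ (h i) f1) (on-c f0) (on-c f1)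
      where
      on-c : ∀ p → hexEdge (h i) p ∈ hexEdges c
      on-c p = hexSet-true⁻ (trans (sym (difference _))
                                   (trans (rotate-difference-on x y (hexEdge-∈ (h i) p)) (xor-≢ d)))
    unique : ∀ i j → DiffersAt x y i → DiffersAt x y j → i ≡ j
    unique i j dᵢ dⱼ = same-hexagon (hexVertex-∈ (h i) f0)
      (subst (λ d → hexVertex (h i) f0 ∈ hexVerts d) (trans (hexagon-of i dᵢ) (sym (hexagon-of j dⱼ)))
             (hexVertex-∈ (h i) f0))
    differing : ∃[ i ] DiffersAt x y i
    differing with any? (λ i → ¬? (lookup x i ≟ᵇ lookup y i))
    ... | yes found = found
    ... | no none = case trans (sym (hexSet-hexEdge c f0)) (trans (sym (difference _)) no-difference) of λ ()
      where
      x≡y : x ≡ y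
      x≡y = lookup-extensionality λ i → decidable-stable (lookup x i ≟ᵇ lookup y i) λ d → none (i , d)
      no-difference : rotate x (hexEdge c f0) xor rotate y (hexEdge c f0) ≡ false
      no-difference = xor-≡ (cong (λ z → rotate z (hexEdge c f0)) x≡y)

  cover : EdgeSet
  cover e = M₀ e ∨ does (onHexagon? e)

  cover-on : ∀ {i e} → e ∈ hexEdges (h i) → cover e ≡ true
  cover-on {i} {e} e∈ = trans (cong (M₀ e ∨_) (dec-true (onHexagon? e) (i , e∈))) (∨-zeroʳ (M₀ e))

  cover-M₀ : ∀ {e} → M₀ e ≡ true → cover e ≡ true
  cover-M₀ {e} e∈ = cong (_∨ does (onHexagon? e)) e∈

  cover⁻ : ∀ {e} → cover e ≡ true → OnHexagon e ⊎ (M₀ e ≡ true × ¬ OnHexagon e)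
  cover⁻ {e} t with onHexagon? e
  ... | yes on  = inj₁ on
  ... | no  off = inj₂ (trans (sym (∨-identityʳ (M₀ e))) t , off)

  cover-full : ∀ i → Full cover (h i)
  cover-full i p = cover-on (hexEdge-∈ (h i) p)

  hexComp-cover : ∀ i → HexComp cover (h i)
  hexComp-cover i = (λ e → cover-on) , closed
    where
    closed : ∀ e v → cover e ≡ true → v ∈ hexVerts (h i) → Incident e v → e ∈ hexEdges (h i)
    closed e v t v∈ inc with cover⁻ t
    ... | inj₁ (j , e∈) with same-hexagon (endpoint-∈-hexVerts (h j) e∈ inc) v∈
    ... | refl = e∈
    closed e v t v∈ inc | inj₂ (e∈M₀ , _) = alternating-matched-edge-∈ pm₀ (h∈ i) (alt₀ i) v∈ e∈M₀ inc

  hexComp-cover-≡ : ∀ {c j v} → HexComp cover c → v ∈ hexVerts c → v ∈ hexVerts (h j) → c ≡ h j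
  hexComp-cover-≡ {c} {j} hc v∈c v∈h with ∈-hexVerts⁻ (h j) v∈h
  ... | k , refl = sym (full-hexComp-≡ {cover} {h j} {c} k (cover-full j) hc v∈c)

  hexComp-cover⁻ : ∀ {c} → c ∈ cells H → HexComp cover c → ∃[ i ] c ≡ h i
  hexComp-cover⁻ {c} c∈ hc with cover⁻ (proj₁ hc _ (hexEdge-∈ c f0)) | cover⁻ (proj₁ hc _ (hexEdge-∈ c f5))
  ... | inj₁ (j , e∈) | _ =
    j , hexComp-cover-≡ hc (hexVertex-∈ c f0) (endpoint-∈-hexVerts (h j) e∈ (incident-self c f0))
  ... | inj₂ _ | inj₁ (j , e∈) =
    j , hexComp-cover-≡ hc (hexVertex-∈ c f0) (endpoint-∈-hexVerts (h j) e∈ (incident-prev c f0))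
  ... | inj₂ (e₀∈ , _) | inj₂ (e₅∈ , _) = contradiction (hexEdge-injective c {f0} {f5}
    (matched-unique pm₀ (hexVertex-∈V c∈ f0) e₀∈ e₅∈ (incident-self c f0) (incident-prev c f0))) λ ()

  edgeComp-cover : ∀ {e} → M₀ e ≡ true → ¬ OnHexagon e → EdgeComp cover e
  edgeComp-cover {e} e∈M₀ off = cover-M₀ e∈M₀ , alone
    where
    alone : ∀ e' v → cover e' ≡ true → Incident e v → Incident e' v → e' ≡ e
    alone e' v t inc inc' with cover⁻ t
    ... | inj₁ (j , e'∈) = contradiction
          (j , alternating-matched-edge-∈ pm₀ (h∈ j) (alt₀ j) (endpoint-∈-hexVerts (h j) e'∈ inc') e∈M₀ inc) off
    ... | inj₂ (e'∈M₀ , _) = matched-unique pm₀ (endpoint-∈V (proj₁ pm₀ e e∈M₀) inc) e'∈M₀ e∈M₀ inc' inc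

  edgeComp-cover⁻ : ∀ {e} → EdgeComp cover e → M₀ e ≡ true × ¬ OnHexagon e
  edgeComp-cover⁻ {e} ec with cover⁻ (proj₁ ec)
  ... | inj₁ (j , e∈) = contradiction e∈ (edgeComp-∉-full {cover} {h j} (cover-full j) ec)
  ... | inj₂ M₀-edge  = M₀-edge

  cover-isClarCover : IsClarCover H cover
  cover-isClarCover = edges , components
    where
    edges : ∀ e → cover e ≡ true → e ∈E cells H
    edges e t with cover⁻ t
    ... | inj₁ (j , e∈)    = h j , h∈ j , e∈
    ... | inj₂ (e∈M₀ , _) = proj₁ pm₀ e e∈M₀
    components : ∀ v → v ∈V cells H → _
    components v v∈ with any? (λ i → v ∈ⱽ.∈? hexVerts (h i))
    ... | yes (i , v∈h) = inj₁ (h i , h∈ i , hexComp-cover i , v∈h)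
    ... | no off with matched-exists pm₀ v∈
    ... | e , e∈M₀ , inc =
      inj₂ (e , edgeComp-cover e∈M₀ (λ (j , e∈) → off (j , endpoint-∈-hexVerts (h j) e∈ inc)) , inc)

  coverCC : ClarCover H
  coverCC = cover , cover-isClarCover

  inF-rotate : ∀ x → InF {H} coverCC (rotatePM x)
  inF-rotate x = alternating , matched
    where
    alternating : ∀ c → c ∈ cells H → HexComp cover c → Alternating (rotate x) c
    alternating c c∈ hc with hexComp-cover⁻ c∈ hc
    ... | i , refl = Alternates⇒Alternating (rotate x) (h i) (rotate-alternates x i)
    matched : ∀ e → EdgeComp cover e → rotate x e ≡ true
    matched e ec = trans (rotate-off x (proj₂ (edgeComp-cover⁻ ec))) (proj₁ (edgeComp-cover⁻ ec))

  inF⇒rotate : ∀ M → InF {H} coverCC M → ∃[ x ] _≈M_ {H} (rotatePM x) M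
  inF⇒rotate (M , pm) (alternating , matched) = x , agrees
    where
    altM : ∀ i → Alternates M (h i)
    altM i = Alternating⇒Alternates M (h i) (alternating (h i) (h∈ i) (hexComp-cover i))
    offset : Fin n → Bool
    offset i = M (hexEdge (h i) f0) xor M₀ (hexEdge (h i) f0)
    x = tabulate offset

    off-hexagons-M⊆M₀ : ∀ {e} → ¬ OnHexagon e → M e ≡ true → M₀ e ≡ true
    off-hexagons-M⊆M₀ {e} off e∈M = M₀-edge-at-end (matched-exists pm₀ v∈)
      where
      v∈ = endpoint-∈V (proj₁ pm e e∈M) (inj₁ refl)
      M₀-edge-at-end : ∃[ m ] (m ∈ₑ M₀ × Incident m (proj₁ (ends e))) → M₀ e ≡ true
      M₀-edge-at-end (m , m∈M₀ , inc) with onHexagon? m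
      ... | yes (j , m∈) = contradiction (j , alternating-matched-edge-∈ pm (h∈ j) (altM j)
                                               (endpoint-∈-hexVerts (h j) m∈ inc) e∈M (inj₁ refl)) off
      ... | no m-off = subst (λ d → M₀ d ≡ true)
                             (matched-unique pm v∈ (matched m (edgeComp-cover m∈M₀ m-off)) e∈M inc (inj₁ refl)) m∈M₀

    off-agrees : ∀ {e} → ¬ OnHexagon e → M₀ e ≡ M e
    off-agrees {e} off with M₀ e in e∈M₀
    ... | true  = sym (matched e (edgeComp-cover e∈M₀ off))
    ... | false = sym (¬-not λ e∈M → case trans (sym e∈M₀) (off-hexagons-M⊆M₀ off e∈M) of λ ())

    agrees : ∀ e → rotate x e ≡ M e
    agrees e with onHexagon? e
    ... | yes (i , e∈) with ∈-hexEdges⁻ (h i) e∈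
    ... | p , refl = begin
      rotate x (hexEdge (h i) p)          ≡⟨ rotate-on x e∈ ⟩
      M₀ (hexEdge (h i) p) xor lookup x i ≡⟨ cong (M₀ (hexEdge (h i) p) xor_) (lookup∘tabulate offset i) ⟩
      M₀ (hexEdge (h i) p) xor offset i   ≡⟨ alternates-difference (alt₀ i) (altM i) p ⟨
      M (hexEdge (h i) p)                 ∎
      where open ≡-Reasoning
    agrees e | no off = trans (rotate-off x off) (off-agrees off)

  cover⇒rotate : ∀ {e} → cover e ≡ true → ∃[ x ] rotate x e ≡ true
  cover⇒rotate {e} t with cover⁻ t
  ... | inj₁ (i , e∈) = x , trans (rotate-on x e∈)
    (trans (cong (M₀ e xor_) (lookup∘update i (replicate n false) (not (M₀ e)))) (xor-inverseʳ (M₀ e)))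
    where
    x = replicate n false [ i ]≔ not (M₀ e)
  ... | inj₂ (e∈M₀ , _) = replicate n false ,
                          trans (cong (M₀ e xor_) (hexSum-zero h e)) (trans (xor-identityʳ (M₀ e)) e∈M₀)

-- Clar covers give cubes

module _ {A : Set} where

  lookup-fromList-∈ : ∀ (xs : List A) i → lookup (fromList xs) i ∈ xs
  lookup-fromList-∈ (x List.∷ xs) zero    = here refl
  lookup-fromList-∈ (x List.∷ xs) (suc i) = there (lookup-fromList-∈ xs i)

  ∈⇒lookup-fromList : ∀ {xs : List A} {x} → x ∈ xs → ∃[ i ] lookup (fromList xs) i ≡ x
  ∈⇒lookup-fromList (here refl) = zero , refl
  ∈⇒lookup-fromList (there x∈)  = let i , eq = ∈⇒lookup-fromList x∈ in suc i , eq

  lookup-fromList-injective : ∀ {xs : List A} → Unique xs → ∀ i j →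
                              lookup (fromList xs) i ≡ lookup (fromList xs) j → i ≡ j
  lookup-fromList-injective {x List.∷ xs} (x∉ ∷ uniq) zero    zero    eq = refl
  lookup-fromList-injective {x List.∷ xs} (x∉ ∷ uniq) zero    (suc j) eq =
    contradiction eq (All.lookup x∉ (lookup-fromList-∈ xs j))
  lookup-fromList-injective {x List.∷ xs} (x∉ ∷ uniq) (suc i) zero    eq =
    contradiction (sym eq) (All.lookup x∉ (lookup-fromList-∈ xs i))
  lookup-fromList-injective {x List.∷ xs} (x∉ ∷ uniq) (suc i) (suc j) eq = cong suc (lookup-fromList-injective uniq i j eq)

module ClarCoverHexagons (H : HexSystem) (C : ClarCover H) where
  open Matchings H
  open ClarCovers H

  full? : ∀ c → Dec (Full (proj₁ C) c)
  full? c = all? λ p → proj₁ C (hexEdge c p) ≟ᵇ true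

  opaque
    fullHexagons : List Cell
    fullHexagons = deduplicate _≟ᶜ_ (filter full? (cells H))

    fullHexagons-unique : Unique fullHexagons
    fullHexagons-unique = deduplicate-! _≟ᶜ_ (filter full? (cells H))

    ∈-fullHexagons⁻ : ∀ {c} → c ∈ fullHexagons → c ∈ cells H × Full (proj₁ C) c
    ∈-fullHexagons⁻ c∈ = ∈-filter⁻ full? (∈-deduplicate⁻ _≟ᶜ_ _ c∈)

    ∈-fullHexagons⁺ : ∀ {c} → c ∈ cells H → Full (proj₁ C) c → c ∈ fullHexagons
    ∈-fullHexagons⁺ c∈ full = ∈-deduplicate⁺ _≟ᶜ_ (∈-filter⁺ full? c∈ full)

  n : ℕ
  n = length fullHexagons

  hs : Vec Cell n
  hs = fromList fullHexagons

  h : Fin n → Cell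
  h = lookup hs

  hs∈ : ∀ i → h i ∈ cells H × Full (proj₁ C) (h i)
  hs∈ i = ∈-fullHexagons⁻ (lookup-fromList-∈ fullHexagons i)

  hs-hexComp : ∀ i → HexComp (proj₁ C) (h i)
  hs-hexComp i = full⇒hexComp (proj₂ C) (proj₁ (hs∈ i)) (proj₂ (hs∈ i))

  hexComp⇒index : ∀ {c} → c ∈ cells H → HexComp (proj₁ C) c → ∃[ i ] h i ≡ c
  hexComp⇒index c∈ hc = ∈⇒lookup-fromList (∈-fullHexagons⁺ c∈ λ p → proj₁ hc _ (hexEdge-∈ _ p))

  hs-disjoint : ∀ {i j} → i ≢ j → Disjoint (h i) (h j)
  hs-disjoint {i} {j} i≢j v∈ v∈' with ∈-hexVerts⁻ (h i) v∈
  ... | k , refl = i≢j (lookup-fromList-injective fullHexagons-unique i j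
                          (full-hexComp-≡ {proj₁ C} {h i} {h j} k (proj₂ (hs∈ i)) (hs-hexComp j) v∈'))

  same-hexagon : ∀ {i j v} → v ∈ hexVerts (h i) → v ∈ hexVerts (h j) → i ≡ j
  same-hexagon = disjoint⇒shared-vertex-≡ {h = h} hs-disjoint

  OddOnHexagon : LEdge → Set
  OddOnHexagon e = ∃[ i ] ∃[ p ] (e ≡ hexEdge (h i) p × oddPosition p ≡ true)

  opaque
    oddOnHexagon? : ∀ e → Dec (OddOnHexagon e)
    oddOnHexagon? e = any? λ i → any? λ p → (e ≟ᴱ hexEdge (h i) p) ×-dec (oddPosition p ≟ᵇ true)

  oddOnHexagon-hexEdge : ∀ i p → does (oddOnHexagon? (hexEdge (h i) p)) ≡ oddPosition p
  oddOnHexagon-hexEdge i p with oddOnHexagon? (hexEdge (h i) p)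
  ... | no none = sym (¬-not λ odd → none (i , p , refl , odd))
  ... | yes (j , q , eq , odd)
    with same-hexagon (endpoint-∈-hexVerts (h j) (subst (_∈ hexEdges (h j)) (sym eq) (hexEdge-∈ (h j) q)) (inj₁ refl))
                      (endpoint-∈-hexVerts (h i) (hexEdge-∈ (h i) p) (inj₁ refl))
  ... | refl = sym (subst (λ r → oddPosition r ≡ true) (sym (hexEdge-injective (h i) eq)) odd)

  -- M₀ keeps the single edges of C and the edges at even positions of its hexagons.
  M₀ : EdgeSet
  M₀ e = proj₁ C e ∧ not (does (oddOnHexagon? e))

  M₀⊆C : ∀ {e} → M₀ e ≡ true → proj₁ C e ≡ true
  M₀⊆C {e} e∈ with proj₁ C e
  ... | true = refl

  M₀-hexEdge : ∀ i p → M₀ (hexEdge (h i) p) ≡ not (oddPosition p)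
  M₀-hexEdge i p = cong₂ (λ a b → a ∧ not b) (proj₂ (hs∈ i) p) (oddOnHexagon-hexEdge i p)

  alt₀ : ∀ i → Alternates M₀ (h i)
  alt₀ i = value⇒alternates true (M₀-hexEdge i)

  not-oddOnHexagon : ∀ {e} → (∀ i → e ∉ hexEdges (h i)) → does (oddOnHexagon? e) ≡ false
  not-oddOnHexagon {e} off =
    dec-false (oddOnHexagon? e) λ (i , p , eq , _) → off i (subst (_∈ hexEdges (h i)) (sym eq) (hexEdge-∈ (h i) p))

  pm₀ : IsPM M₀
  pm₀ = (λ e e∈ → proj₁ (proj₂ C) e (M₀⊆C e∈)) , vertices
    where
    vertices : ∀ v → v ∈V cells H → MatchedOnce M₀ v
    vertices v v∈ with proj₂ (proj₂ C) v v∈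
    ... | inj₁ (c , c∈ , hc , v∈c) with hexComp⇒index c∈ hc | ∈-hexVerts⁻ c v∈c
    ... | i , refl | k , refl = alternating-matchedOnce k (alt₀ i) λ e∈ inc → proj₂ hc _ _ (M₀⊆C e∈) v∈c inc
    vertices v v∈ | inj₂ (e₀ , ec , inc₀) = (e₀ , e₀∈M₀ , inc₀) , λ e e' e∈ e'∈ inc inc' →
      trans (proj₂ ec e v (M₀⊆C e∈) inc₀ inc) (sym (proj₂ ec e' v (M₀⊆C e'∈) inc₀ inc'))
      where
      e₀∈M₀ : M₀ e₀ ≡ true
      e₀∈M₀ = cong₂ (λ a b → a ∧ not b) (proj₁ ec)
                (not-oddOnHexagon λ i → edgeComp-∉-full {proj₁ C} {h i} (proj₂ (hs∈ i)) ec)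

  module Cube = HexagonCube H M₀ pm₀ h (proj₁ ∘ hs∈) alt₀ hs-disjoint

  C≈cover : ∀ e → proj₁ C e ≡ Cube.cover e
  C≈cover e with Cube.onHexagon? e
  ... | yes (i , e∈) with ∈-hexEdges⁻ (h i) e∈
  ... | p , refl = trans (proj₂ (hs∈ i) p) (sym (∨-zeroʳ (M₀ (hexEdge (h i) p))))
  C≈cover e | no off = begin
    proj₁ C e                                  ≡⟨ ∧-identityʳ (proj₁ C e) ⟨
    proj₁ C e ∧ true                           ≡⟨ cong (λ b → proj₁ C e ∧ not b) (not-oddOnHexagon (curry off)) ⟨
    M₀ e                                       ≡⟨ ∨-identityʳ (M₀ e) ⟨
    M₀ e ∨ false                               ∎
    where open ≡-Reasoning

  inF⇔rotate : ∀ M → InF {H} C M ⇔ (∃[ x ] _≈M_ {H} (Cube.rotatePM x) M)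
  inF⇔rotate M = mk⇔ (λ inF → Cube.inF⇒rotate M (inF-resp {C} {Cube.coverCC} {M} C≈cover inF))
                     (λ (x , eq) → inF-respᴹ {C} {Cube.rotatePM x} {M} eq
                       (inF-resp {Cube.coverCC} {C} {Cube.rotatePM x} (λ e → sym (C≈cover e)) (Cube.inF-rotate x)))

-- Induced cubes come from Clar covers

at-most-one-common-edge : ∀ {c c' p q} → c ≢ c' →
                          hexSet c' (hexEdge c p) ≡ true → hexSet c' (hexEdge c q) ≡ true → p ≡ q
at-most-one-common-edge {c} {c'} {p} {q} c≢c' p∈ q∈ with p Fin.≟ q
... | yes p≡q = p≡q
... | no  p≢q = contradiction (two-common-edges⇒≡ (hexEdge-≢ c p≢q) (hexEdge-∈ c p) (hexEdge-∈ c q)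
                                 (hexSet-true⁻ p∈) (hexSet-true⁻ q∈)) c≢c'

-- In a 4-cycle of the resonance graph, opposite edges carry the same hexagon.
module Square {X Y Z W : Cell} (X≢Y : X ≢ Y) (X≢W : X ≢ W)
              (square : ∀ e → hexSet X e xor hexSet Y e ≡ hexSet W e xor hexSet Z e) where

  Free : Fin 6 → Set
  Free p = hexSet Y (hexEdge X p) ≡ false × hexSet W (hexEdge X p) ≡ false

  Hit : Fin 6 → Set
  Hit p = hexSet Y (hexEdge X p) ≡ true ⊎ hexSet W (hexEdge X p) ≡ true

  classify : ∀ p → Free p ⊎ Hit p
  classify p = by-values _ _ refl refl
    where
    by-values : ∀ a b → hexSet Y (hexEdge X p) ≡ a → hexSet W (hexEdge X p) ≡ b → Free p ⊎ Hit p
    by-values true  _     y w = inj₂ (inj₁ y)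
    by-values false true  y w = inj₂ (inj₂ w)
    by-values false false y w = inj₁ (y , w)

  not-three-hits : ∀ {a b c} → a ≢ b → a ≢ c → b ≢ c → Hit a → Hit b → Hit c → ⊥
  not-three-hits a≢b a≢c b≢c (inj₁ a∈) (inj₁ b∈) _          = a≢b (at-most-one-common-edge X≢Y a∈ b∈)
  not-three-hits a≢b a≢c b≢c (inj₂ a∈) (inj₂ b∈) _          = a≢b (at-most-one-common-edge X≢W a∈ b∈)
  not-three-hits a≢b a≢c b≢c (inj₁ a∈) (inj₂ b∈) (inj₁ c∈) = a≢c (at-most-one-common-edge X≢Y a∈ c∈)
  not-three-hits a≢b a≢c b≢c (inj₁ a∈) (inj₂ b∈) (inj₂ c∈) = b≢c (at-most-one-common-edge X≢W b∈ c∈)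
  not-three-hits a≢b a≢c b≢c (inj₂ a∈) (inj₁ b∈) (inj₁ c∈) = b≢c (at-most-one-common-edge X≢Y b∈ c∈)
  not-three-hits a≢b a≢c b≢c (inj₂ a∈) (inj₁ b∈) (inj₂ c∈) = a≢c (at-most-one-common-edge X≢W a∈ c∈)

  free-among : ∀ {a b c} → a ≢ b → a ≢ c → b ≢ c → Free a ⊎ Free b ⊎ Free c
  free-among {a} {b} {c} a≢b a≢c b≢c with classify a | classify b | classify c
  ... | inj₁ free | _         | _         = inj₁ free
  ... | inj₂ _    | inj₁ free | _         = inj₂ (inj₁ free)
  ... | inj₂ _    | inj₂ _    | inj₁ free = inj₂ (inj₂ free)
  ... | inj₂ ha   | inj₂ hb   | inj₂ hc   = ⊥-elim (not-three-hits a≢b a≢c b≢c ha hb hc)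

  free-pair : ∃[ p ] ∃[ q ] (p ≢ q × Free p × Free q)
  free-pair = combine (free-among {f0} {f1} {f2} (λ ()) (λ ()) (λ ())) (free-among {f3} {f4} {f5} (λ ()) (λ ()) (λ ()))
    where
    combine : Free f0 ⊎ Free f1 ⊎ Free f2 → Free f3 ⊎ Free f4 ⊎ Free f5 →
              ∃[ p ] ∃[ q ] (p ≢ q × Free p × Free q)
    combine (inj₁ a)        (inj₁ b)        = f0 , f3 , (λ ()) , a , b
    combine (inj₁ a)        (inj₂ (inj₁ b)) = f0 , f4 , (λ ()) , a , b
    combine (inj₁ a)        (inj₂ (inj₂ b)) = f0 , f5 , (λ ()) , a , b
    combine (inj₂ (inj₁ a)) (inj₁ b)        = f1 , f3 , (λ ()) , a , b
    combine (inj₂ (inj₁ a)) (inj₂ (inj₁ b)) = f1 , f4 , (λ ()) , a , b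
    combine (inj₂ (inj₁ a)) (inj₂ (inj₂ b)) = f1 , f5 , (λ ()) , a , b
    combine (inj₂ (inj₂ a)) (inj₁ b)        = f2 , f3 , (λ ()) , a , b
    combine (inj₂ (inj₂ a)) (inj₂ (inj₁ b)) = f2 , f4 , (λ ()) , a , b
    combine (inj₂ (inj₂ a)) (inj₂ (inj₂ b)) = f2 , f5 , (λ ()) , a , b

  free-∈-Z : ∀ p → Free p → hexEdge X p ∈ hexEdges Z
  free-∈-Z p (y , w) = hexSet-true⁻ (trans (xor-solveˡ (hexSet W (hexEdge X p)) (sym (square (hexEdge X p))))
                                            (cong₂ _xor_ w (cong₂ _xor_ (hexSet-hexEdge X p) y)))

  X≡Z : X ≡ Z
  X≡Z with free-pair
  ... | p , q , p≢q , free-p , free-q =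
    two-common-edges⇒≡ (hexEdge-≢ X p≢q) (hexEdge-∈ X p) (hexEdge-∈ X q) (free-∈-Z p free-p) (free-∈-Z q free-q)

  opposite-sides : ∀ e → hexSet Y e ≡ hexSet W e
  opposite-sides e = xor-cancel-swap (hexSet X e) (trans (square e) (cong (λ z → hexSet W e xor hexSet z e) (sym X≡Z)))
    where
    xor-cancel-swap : ∀ a {y w} → a xor y ≡ w xor a → y ≡ w
    xor-cancel-swap a {y} {w} eq = xor-cancelˡ a (trans eq (xor-comm w a))

module InducedCubeHexagons (H : HexSystem) (Q : InducedCube H) where
  open Matchings H
  open ClarCovers H

  n : ℕ
  n = proj₁ (proj₂ Q)

  g : Vec Bool n → PM H
  g = proj₁ (proj₂ (proj₂ Q))

  g-onto : ∀ M → proj₁ Q M ⇔ (∃[ x ] _≈M_ {H} (g x) M)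
  g-onto = proj₁ (proj₂ (proj₂ (proj₂ Q)))

  g-injective : ∀ x y → proj₁ (g x) ≗ proj₁ (g y) → x ≡ y
  g-injective = proj₁ (proj₂ (proj₂ (proj₂ (proj₂ Q))))

  g-adjacent : ∀ x y → CubeAdj x y ⇔ ResAdj {H} (g x) (g y)
  g-adjacent = proj₂ (proj₂ (proj₂ (proj₂ (proj₂ Q))))

  gM : Vec Bool n → EdgeSet
  gM x = proj₁ (g x)

  0⃗ : Vec Bool n
  0⃗ = replicate n false

  M₀ : EdgeSet
  M₀ = gM 0⃗

  set-difference : ∀ (x : Vec Bool n) i → lookup x i ≡ false →
                   ∃[ c ] (c ∈ cells H × ∀ e → gM x e xor gM (x [ i ]≔ true) e ≡ hexSet c e)
  set-difference x i xᵢ with Equivalence.to (g-adjacent x (x [ i ]≔ true)) (set-hamming≡1 x i xᵢ)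
  ... | c , c∈ , r = c , c∈ , Equivalence.to (resonance⇔hexSet {gM x} {gM (x [ i ]≔ true)}) r

  unit : Fin n → Vec Bool n
  unit i = 0⃗ [ i ]≔ true

  unit-off : ∀ {i j} → j ≢ i → lookup (unit i) j ≡ false
  unit-off {i} {j} j≢i = trans (lookup∘update′ j≢i 0⃗ true) (lookup-replicate j false)

  hexagon : Fin n → Cell
  hexagon i = proj₁ (set-difference 0⃗ i (lookup-replicate i false))

  hexagon-∈ : ∀ i → hexagon i ∈ cells H
  hexagon-∈ i = proj₁ (proj₂ (set-difference 0⃗ i (lookup-replicate i false)))

  hexagon-difference : ∀ i e → M₀ e xor gM (unit i) e ≡ hexSet (hexagon i) e
  hexagon-difference i = proj₂ (proj₂ (set-difference 0⃗ i (lookup-replicate i false)))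

  -- Holds at 0⃗ by the definition of hexagon; the square lemma propagates it to every x.
  Flips : Vec Bool n → Set
  Flips x = ∀ i → lookup x i ≡ false → ∀ e → gM x e xor gM (x [ i ]≔ true) e ≡ hexSet (hexagon i) e

  flips-set : ∀ {x} → Flips x → ∀ {i} → lookup x i ≡ false →
              ∀ e → gM (x [ i ]≔ true) e ≡ gM x e xor hexSet (hexagon i) e
  flips-set {x} fl {i} xᵢ e = xor-solveˡ (gM x e) (fl i xᵢ e)

  flips-step : ∀ y m → lookup y m ≡ false → Flips y → Flips (y [ m ]≔ true)
  flips-step y m yₘ fl i bᵢ e = trans (proj₂ (proj₂ Y) e) (Square.opposite-sides X≢Y X≢W square e)
    where
    b = y [ m ]≔ true
    i≢m : i ≢ m
    i≢m refl = case trans (sym bᵢ) (lookup∘update m y true) of λ ()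
    yᵢ : lookup y i ≡ false
    yᵢ = trans (sym (lookup∘update′ i≢m y true)) bᵢ
    d = y [ i ]≔ true
    dₘ : lookup d m ≡ false
    dₘ = trans (lookup∘update′ (i≢m ∘ sym) y true) yₘ
    Y = set-difference b i bᵢ
    Z = set-difference d m dₘ
    X = hexagon m
    W = hexagon i
    to-bi : d [ m ]≔ true ≡ b [ i ]≔ true
    to-bi = []≔-commutes y i m i≢m
    square : ∀ e → hexSet X e xor hexSet (proj₁ Y) e ≡ hexSet W e xor hexSet (proj₁ Z) e
    square e = begin
      hexSet X e xor hexSet (proj₁ Y) e                     ≡⟨ cong₂ _xor_ (fl m yₘ e) (proj₂ (proj₂ Y) e) ⟨
      (gM y e xor gM b e) xor (gM b e xor gM (b [ i ]≔ true) e) ≡⟨ xor-chain (gM y e) _ _ ⟩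
      gM y e xor gM (b [ i ]≔ true) e                       ≡⟨ xor-chain (gM y e) _ _ ⟨
      (gM y e xor gM d e) xor (gM d e xor gM (b [ i ]≔ true) e) ≡⟨ cong₂ _xor_ (fl i yᵢ e) d-side ⟩
      hexSet W e xor hexSet (proj₁ Z) e                     ∎
      where
      open ≡-Reasoning
      d-side : gM d e xor gM (b [ i ]≔ true) e ≡ hexSet (proj₁ Z) e
      d-side = subst (λ z → gM d e xor gM z e ≡ hexSet (proj₁ Z) e) to-bi (proj₂ (proj₂ Z) e)
    X≢Y : X ≢ proj₁ Y
    X≢Y X≡Y = case trans (sym yₘ) (trans (cong (λ z → lookup z m) y≡bi)
                         (trans (lookup∘update′ (i≢m ∘ sym) b true) (lookup∘update m y true))) of λ ()
      where
      y≡bi : y ≡ b [ i ]≔ true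
      y≡bi = g-injective y _ λ e → xor-false⁻ (begin
        gM y e xor gM (b [ i ]≔ true) e                         ≡⟨ xor-chain (gM y e) (gM b e) _ ⟨
        (gM y e xor gM b e) xor (gM b e xor gM (b [ i ]≔ true) e) ≡⟨ cong₂ _xor_ (fl m yₘ e) (proj₂ (proj₂ Y) e) ⟩
        hexSet X e xor hexSet (proj₁ Y) e                     ≡⟨ cong (λ z → hexSet X e xor hexSet z e) X≡Y ⟨
        hexSet X e xor hexSet X e                             ≡⟨ xor-same (hexSet X e) ⟩
        false                                                 ∎)
        where open ≡-Reasoning
    X≢W : X ≢ W
    X≢W X≡W = case trans (sym (lookup∘update m y true)) (trans (cong (λ z → lookup z m) b≡d) dₘ) of λ ()
      where
      b≡d : b ≡ d
      b≡d = g-injective b d λ e →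
        trans (flips-set fl yₘ e) (trans (cong (λ z → gM y e xor hexSet z e) X≡W) (sym (flips-set fl yᵢ e)))

  Sums : Vec Bool n → Set
  Sums x = ∀ e → gM x e ≡ M₀ e xor hexSum x hexagon e

  sums-step : ∀ y m → lookup y m ≡ false → Flips y → Sums y → Sums (y [ m ]≔ true)
  sums-step y m yₘ fl sm e = begin
    gM (y [ m ]≔ true) e                                       ≡⟨ flips-set fl yₘ e ⟩
    gM y e xor hexSet (hexagon m) e                            ≡⟨ cong (_xor hexSet (hexagon m) e) (sm e) ⟩
    (M₀ e xor hexSum y hexagon e) xor hexSet (hexagon m) e     ≡⟨ xor-assoc (M₀ e) _ _ ⟩
    M₀ e xor (hexSum y hexagon e xor hexSet (hexagon m) e)     ≡⟨ cong (M₀ e xor_) (hexSum-update y hexagon e m yₘ) ⟨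
    M₀ e xor hexSum (y [ m ]≔ true) hexagon e                 ∎
    where open ≡-Reasoning

  flips-sums : ∀ x → Flips x × Sums x
  flips-sums = bool-vector-induction (λ x → Flips x × Sums x)
    ((λ i _ → hexagon-difference i) ,
     λ e → sym (trans (cong (M₀ e xor_) (hexSum-zero hexagon e)) (xor-identityʳ (M₀ e))))
    λ y m yₘ (fl , sm) → flips-step y m yₘ fl , sums-step y m yₘ fl sm

  M₀-alternates : ∀ i → Alternates M₀ (hexagon i)
  M₀-alternates i = resonance⇒alternates (proj₂ (g 0⃗)) (proj₂ (g (unit i))) (hexagon-∈ i) (hexagon-difference i)

  unit-alternates : ∀ i j → Alternates (gM (unit i)) (hexagon j)
  unit-alternates i j with i Fin.≟ j
  ... | yes refl = resonance⇒alternates (proj₂ (g (unit i))) (proj₂ (g 0⃗)) (hexagon-∈ i)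
                     λ e → trans (xor-comm (gM (unit i) e) (M₀ e)) (hexagon-difference i e)
  ... | no i≢j = resonance⇒alternates (proj₂ (g (unit i))) (proj₂ (g (unit i [ j ]≔ true))) (hexagon-∈ j)
                   (proj₁ (flips-sums (unit i)) j (unit-off (i≢j ∘ sym)))

  unit-hexagon : ∀ i e → gM (unit i) e ≡ M₀ e xor hexSet (hexagon i) e
  unit-hexagon i e = xor-solveˡ (M₀ e) (hexagon-difference i e)

  hexagon-injective : ∀ {i j} → hexagon i ≡ hexagon j → i ≡ j
  hexagon-injective {i} {j} eq with i Fin.≟ j
  ... | yes i≡j = i≡j
  ... | no  i≢j = case trans (sym (lookup∘update i 0⃗ true)) (trans (cong (λ x → lookup x i) unit≡) (unit-off i≢j)) of λ ()
    where
    unit≡ : unit i ≡ unit j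
    unit≡ = g-injective (unit i) (unit j) λ e →
      trans (unit-hexagon i e) (trans (cong (λ c → M₀ e xor hexSet c e) eq) (sym (unit-hexagon j e)))

  hexagons-disjoint : ∀ {i j} → i ≢ j → Disjoint (hexagon i) (hexagon j)
  hexagons-disjoint {i} {j} i≢j {v} v∈i v∈j = conclude (matched-exists pm₀ v∈V) (matched-exists pmᵢ v∈V)
    where
    pm₀ = proj₂ (g 0⃗)
    pmᵢ = proj₂ (g (unit i))
    v∈V : v ∈V cells H
    v∈V = hexagon i , hexagon-∈ i , v∈i
    conclude : ∃[ e ] (e ∈ₑ M₀ × Incident e v) → ∃[ e ] (e ∈ₑ gM (unit i) × Incident e v) → ⊥
    conclude (m , m∈ , inc) (m' , m'∈ , inc') = i≢j (hexagon-injective (two-common-edges⇒≡ m≢m'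
        (alternating-matched-edge-∈ pm₀ (hexagon-∈ i) (M₀-alternates i) v∈i m∈ inc)
        (alternating-matched-edge-∈ pmᵢ (hexagon-∈ i) (unit-alternates i i) v∈i m'∈ inc')
        (alternating-matched-edge-∈ pm₀ (hexagon-∈ j) (M₀-alternates j) v∈j m∈ inc)
        (alternating-matched-edge-∈ pmᵢ (hexagon-∈ j) (unit-alternates i j) v∈j m'∈ inc')))
      where
      m≢m' : m ≢ m'
      m≢m' refl = case trans (sym m'∈) (trans (unit-hexagon i m) (cong₂ _xor_ m∈ (hexSet-∈
                    (alternating-matched-edge-∈ pm₀ (hexagon-∈ i) (M₀-alternates i) v∈i m∈ inc)))) of λ ()

  module Cube = HexagonCube H M₀ (proj₂ (g 0⃗)) hexagon hexagon-∈ M₀-alternates hexagons-disjoint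

  g≗rotate : ∀ x → gM x ≗ Cube.rotate x
  g≗rotate x = proj₂ (flips-sums x)

  rotate≈g : ∀ x → _≈M_ {H} (Cube.rotatePM x) (g x)
  rotate≈g x e = sym (g≗rotate x e)

  inF⇔Q : ∀ M → InF {H} Cube.coverCC M ⇔ proj₁ Q M
  inF⇔Q M = mk⇔ (to ∘ Cube.inF⇒rotate M) (from ∘ Equivalence.to (g-onto M))
    where
    to : ∃[ x ] _≈M_ {H} (Cube.rotatePM x) M → proj₁ Q M
    to (x , eq) = Equivalence.from (g-onto M) (x , λ e → trans (g≗rotate x e) (eq e))
    from : ∃[ x ] _≈M_ {H} (g x) M → InF {H} Cube.coverCC M
    from (x , eq) = inF-respᴹ {Cube.coverCC} {g x} {M} eq
                      (inF-respᴹ {Cube.coverCC} {Cube.rotatePM x} {g x} (rotate≈g x) (Cube.inF-rotate x))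


-- The isomorphism

module ClarCoverPoset (H : HexSystem) where
  open Matchings H
  open ClarCovers H

  ⊆⇒inF : ∀ (C : ClarCover H) {e} → proj₁ C e ≡ true → ∃[ M ] (InF {H} C M × proj₁ M e ≡ true)
  ⊆⇒inF C {e} e∈C = witness (D.Cube.cover⇒rotate (trans (sym (D.C≈cover e)) e∈C))
    where
    module D = ClarCoverHexagons H C
    witness : ∃[ x ] D.Cube.rotate x e ≡ true → ∃[ M ] (InF {H} C M × proj₁ M e ≡ true)
    witness (x , e∈) = D.Cube.rotatePM x , Equivalence.from (D.inF⇔rotate (D.Cube.rotatePM x)) (x , λ _ → refl) , e∈

  ≤C⇒⊆ : ∀ {C C' : ClarCover H} → _≤C_ {H} C C' → ∀ {e} → proj₁ C e ≡ true → proj₁ C' e ≡ true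
  ≤C⇒⊆ {C} {C'} C≤C' e∈C = let M , inF , e∈M = ⊆⇒inF C e∈C in inF⇒⊆ C' M (C≤C' M inF) e∈M

  ≤C-antisym : ∀ {C C' : ClarCover H} → _≤C_ {H} C C' → _≤C_ {H} C' C → _≈C_ {H} C C'
  ≤C-antisym {C} {C'} C≤C' C'≤C e = ⇔→≡ (mk⇔ (≤C⇒⊆ {C} {C'} C≤C') (≤C⇒⊆ {C'} {C} C'≤C))

  ≤C-isPartialOrder : IsPartialOrder (_≈C_ {H}) (_≤C_ {H})
  ≤C-isPartialOrder = record
    { isPreorder = record
      { isEquivalence = record
        { refl = λ e → refl ; sym = λ eq e → sym (eq e) ; trans = λ eq eq' e → trans (eq e) (eq' e) }
      ; reflexive     = λ {C} {C'} eq M → inF-resp {C} {C'} {M} eq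
      ; trans         = λ C≤C' C'≤C'' M → C'≤C'' M ∘ C≤C' M
      }
    ; antisym = λ {C} {C'} → ≤C-antisym {C} {C'}
    }

  f : ClarCover H → InducedCube H
  f C = InF {H} C , D.n , D.Cube.rotatePM , D.inF⇔rotate , D.Cube.rotate-injective ,
        λ x y → mk⇔ (D.Cube.cubeAdj⇒resAdj x y) (D.Cube.resAdj⇒cubeAdj x y)
    where module D = ClarCoverHexagons H C

  f-surjective : ∀ Q → ∃[ C ] ∀ {C'} → _≈C_ {H} C' C → _≈Q_ {H} (f C') Q
  f-surjective Q = Q.Cube.coverCC , λ {C'} C'≈cover M →
    mk⇔ (Equivalence.to (Q.inF⇔Q M) ∘ inF-resp {C'} {Q.Cube.coverCC} {M} C'≈cover)
        (inF-resp {Q.Cube.coverCC} {C'} {M} (λ e → sym (C'≈cover e)) ∘ Equivalence.from (Q.inF⇔Q M))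
    where module Q = InducedCubeHexagons H Q

  f-isOrderIsomorphism : IsOrderIsomorphism (_≈C_ {H}) (_≈Q_ {H}) (_≤C_ {H}) (_≤Q_ {H}) f
  f-isOrderIsomorphism = record
    { isOrderMonomorphism = record
      { isOrderHomomorphism = record
        { cong = λ {C} {C'} eq M → mk⇔ (inF-resp {C} {C'} {M} eq) (inF-resp {C'} {C} {M} (λ e → sym (eq e)))
        ; mono = λ C≤C' → C≤C'
        }
      ; injective = λ {C} {C'} eq → ≤C-antisym {C} {C'} (λ M → Equivalence.to (eq M)) (λ M → Equivalence.from (eq M))
      ; cancel    = λ fC≤fC' → fC≤fC'
      }
    ; surjective = f-surjective
    }

theorem2 : (H : HexSystem) → Kekulean H →
    IsPartialOrder (_≈C_ {H}) (_≤C_ {H}) ×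
    ∃ (λ (φ : ClarCover H → InducedCube H) →
      IsOrderIsomorphism (_≈C_ {H}) (_≈Q_ {H}) (_≤C_ {H}) (_≤Q_ {H}) φ)
theorem2 H _ = ≤C-isPartialOrder , f , f-isOrderIsomorphism
  where open ClarCoverPoset H
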